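{- Let $|q|<1$, $x\in\mathbb{C}$, and $k\ge 1$ an integer. Then \[ \frac{1}{(q^2;q^2)_\infty} \sum_{n\geq 0} q^{(2k+1)n^2} \big(V_n(x)+V_{n-1}(x)\big) =\sum_{n_k\geq n_{k-1}\geq \cdots \geq n_1\geq 0} \frac{q^{2(n_1^2+\cdots +n_k^2)}\prod_{j=1}^{n_1} (1+2xq^{2j-1}+q^{4j-2})}{(q^2;q^2)_{n_k-n_{k-1}}(q^2;q^2)_{n_{k-1}-n_{k-2}}\cdots (q^2;q^2)_{n_2-n_1}(q^2;q^2)_{2n_1}}. \]
   Context: $(a;q)_n=\prod_{i=0}^{n-1}(1-aq^i)$, $(a;q)_\infty=\prod_{i\ge0}(1-aq^i)$. $V_n(x)$ is the Chebyshev polynomial of the third kind: $V_0=1$, $V_1=2x-1$, $V_n=2xV_{n-1}-V_{n-2}$ ($n>1$), and $V_n=0$ for $n<0$. For $k=1$ the sum is over $n_1\ge0$ only, with denominator $(q^2;q^2)_{2n_1}$. -}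

module Defs where

open import Level using (Level)
open import Data.Nat using (ℕ; zero; suc; _≡ᵇ_) renaming (_+_ to _+ℕ_; _*_ to _*ℕ_; _∸_ to _∸ℕ_)
open import Data.Bool using (if_then_else_)
open import Algebra.Bundles using (CommutativeRing)

-- Formal power series in q with coefficients in a commutative ring R,
-- represented by their coefficient sequences ℕ → Carrier.
module Series {c ℓ : Level} (R : CommutativeRing c ℓ) where
  open CommutativeRing R using (Carrier; _+_; _*_; _-_; 0#; 1#)

  PS : Set c
  PS = ℕ → Carrier

  Σ< : ℕ → (ℕ → Carrier) → Carrier
  Σ< zero    f = 0#
  Σ< (suc n) f = Σ< n f + f n

  two : Carrier
  two = 1# + 1#

  mono : ℕ → PS
  mono e n = if e ≡ᵇ n then 1# else 0#

  oneS : PS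
  oneS = mono 0

  _⊕_ : PS → PS → PS
  (f ⊕ g) n = f n + g n

  _⊖_ : PS → PS → PS
  (f ⊖ g) n = f n - g n

  scale : Carrier → PS → PS
  scale a f n = a * f n

  _⊛_ : PS → PS → PS
  (f ⊛ g) n = Σ< (suc n) (λ i → f i * g (n ∸ℕ i))

  powS : PS → ℕ → PS
  powS f zero    = oneS
  powS f (suc j) = powS f j ⊛ f

  ΣS< : ℕ → (ℕ → PS) → PS
  ΣS< n F m = Σ< n (λ i → F i m)

  -- multiplicative inverse of a series with constant term 1:
  -- 1/f = Σ_j (1 - f)^j, whose N-th coefficient only involves j ≤ N
  invS : PS → PS
  invS f N = Σ< (suc N) (λ j → powS (oneS ⊖ f) j N)

  qp2 : ℕ → PS
  qp2 zero    = oneS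
  qp2 (suc n) = qp2 n ⊛ (oneS ⊖ mono (2 *ℕ suc n))

  -- (q^2;q^2)_∞ : its N-th coefficient agrees with that of (q^2;q^2)_N
  qp2∞ : PS
  qp2∞ N = qp2 N N

  module _ (x : Carrier) where
    V : ℕ → Carrier
    V zero          = 1#
    V (suc zero)    = two * x - 1#
    V (suc (suc n)) = two * x * V (suc n) - V n

    -- V_n(x) + V_{n-1}(x), with V_{-1} = 0
    W : ℕ → Carrier
    W zero    = V zero
    W (suc n) = V (suc n) + V n

    thetaS : ℕ → PS
    thetaS k m = Σ< (suc m) (λ n → W n * mono ((2 *ℕ k +ℕ 1) *ℕ (n *ℕ n)) m)

    LHS : ℕ → PS
    LHS k = invS qp2∞ ⊛ thetaS k

    P : ℕ → PS
    P zero    = oneS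
    P (suc j) = P j ⊛ ((oneS ⊕ scale (two * x) (mono (2 *ℕ suc j ∸ℕ 1)))
                        ⊕ mono (4 *ℕ suc j ∸ℕ 2))

    -- chain j m : sum over m = n_j ≥ n_{j-1} ≥ ... ≥ n_1 ≥ 0 of
    --   q^{2(n_1^2+...+n_j^2)} P(n_1) /
    --   ((q^2;q^2)_{n_j-n_{j-1}} ... (q^2;q^2)_{n_2-n_1} (q^2;q^2)_{2n_1})
    -- (chain 0 is unused)
    chain : ℕ → ℕ → PS
    chain zero          m = λ _ → 0#
    chain (suc zero)    m = (mono (2 *ℕ (m *ℕ m)) ⊛ P m) ⊛ invS (qp2 (2 *ℕ m))
    chain (suc (suc j)) m =
      mono (2 *ℕ (m *ℕ m)) ⊛ ΣS< (suc m) (λ n → invS (qp2 (m ∸ℕ n)) ⊛ chain (suc j) n)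

    -- Σ_{n_k ≥ 0} chain k n_k : at coefficient N only n_k ≤ N contribute
    -- (the factor q^{2 n_k^2} has degree > N otherwise)
    RHS : ℕ → PS
    RHS k N = Σ< (suc N) (λ m → chain k m N)

-- Writing α_r = (V_r + V_{r-1}) q^{r²}, the polynomial
-- Π_{j≤n}(1 + 2x q^{2j-1} + q^{4j-2}) equals Σ_r α_r [2n, n-r]_{q²}, which
-- (after dividing by (q²;q²)_{2n}) says that (α, β) with
-- β_n = P(n)/(q²;q²)_{2n} is a Bailey pair relative to a = 1 in base q².
-- Each application of the Bailey lemma multiplies α_r by q^{2r²} and turns
-- β into one more level of the multiple sum; the last, infinite, level
-- leaves the factor 1/(q²;q²)_∞ in front of Σ_r q^{2r²} α_r.  Both the
-- Bailey lemma and its limit rest on a q-Chu–Vandermonde summation, proved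
-- by induction on the q-Pascal recurrence.

module Submission where

open import Defs
open import Level using (Level)
open import Algebra.Bundles using (CommutativeRing)
open import Algebra.Structures using (IsCommutativeRing)
open import Data.Nat as ℕ using (ℕ; zero; suc; _≤_; _<_; z≤n; s≤s; _∸_; _≤?_; _≡ᵇ_)
import Data.Nat.Properties as NP
open import Data.Nat.Tactic.RingSolver using (solve-∀)
open import Data.Integer as ℤ using (ℤ; +_; -[1+_])
import Data.Integer.Properties as ℤP
import Data.Sign as Sign
open import Data.Bool using (true; false; T)
open import Data.Maybe using (Maybe; just; nothing)
open import Data.Product using (_,_)
open import Data.Empty using (⊥-elim)
open import Relation.Binary.PropositionalEquality as P using (_≡_)
open import Relation.Nullary using (yes; no; Dec; ¬_)
import Relation.Binary.Reasoning.Setoid as SetoidReasoning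
import Algebra.Properties.Ring as RingProperties
import Algebra.Properties.Semiring.Mult.TCOptimised as SemiringMult
open import Algebra.Solver.Ring.AlmostCommutativeRing
  using (fromCommutativeRing; _-Raw-AlmostCommutative⟶_)
import Algebra.Solver.Ring as RingSolver

-- The stdlib ring solver needs a coefficient ring with decidable equality;
-- the integers map into every commutative ring.
module IntegerRingSolver {c ℓ : Level} (CR : CommutativeRing c ℓ) where
  open CommutativeRing CR
  open SetoidReasoning setoid
  open RingProperties ring using (-‿distribˡ-*; -‿distribʳ-*; -‿involutive; -‿+-comm; -0#≈0#)
  open SemiringMult semiring using (_×_; 1+×; ×-homo-+; ×1-homo-*)

  ⟦_⟧ℤ : ℤ → Carrier
  ⟦ + n ⟧ℤ     = n × 1#
  ⟦ -[1+ n ] ⟧ℤ = - (suc n × 1#)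

  ⟦-⟧-homo : ∀ z → ⟦ ℤ.- z ⟧ℤ ≈ - ⟦ z ⟧ℤ
  ⟦-⟧-homo (+ zero)  = sym -0#≈0#
  ⟦-⟧-homo (+ suc n) = refl
  ⟦-⟧-homo -[1+ n ]  = sym (-‿involutive _)

  ⟦⊖⟧-homo : ∀ m n → ⟦ m ℤ.⊖ n ⟧ℤ ≈ m × 1# - n × 1#
  ⟦⊖⟧-homo zero    zero    = sym (-‿inverseʳ _)
  ⟦⊖⟧-homo zero    (suc n) = sym (+-identityˡ _)
  ⟦⊖⟧-homo (suc m) zero    = sym (trans (+-congˡ -0#≈0#) (+-identityʳ _))
  ⟦⊖⟧-homo (suc m) (suc n) = begin
    ⟦ suc m ℤ.⊖ suc n ⟧ℤ        ≡⟨ P.cong ⟦_⟧ℤ (ℤP.[1+m]⊖[1+n]≡m⊖n m n) ⟩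
    ⟦ m ℤ.⊖ n ⟧ℤ                ≈⟨ ⟦⊖⟧-homo m n ⟩
    m × 1# - n × 1#             ≈⟨ shift ⟩
    (1# + m × 1#) - (1# + n × 1#) ≈⟨ +-cong (sym (1+× m 1#)) (-‿cong (sym (1+× n 1#))) ⟩
    suc m × 1# - suc n × 1#     ∎
    where
    shift : m × 1# - n × 1# ≈ (1# + m × 1#) - (1# + n × 1#)
    shift = begin
      m × 1# - n × 1#                    ≈⟨ sym (+-identityˡ _) ⟩
      0# + (m × 1# - n × 1#)             ≈⟨ +-congʳ (sym (-‿inverseʳ 1#)) ⟩
      (1# - 1#) + (m × 1# - n × 1#)      ≈⟨ +-assoc _ _ _ ⟩
      1# + (- 1# + (m × 1# - n × 1#))    ≈⟨ +-congˡ (sym (+-assoc _ _ _)) ⟩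
      1# + ((- 1# + m × 1#) - n × 1#)    ≈⟨ +-congˡ (+-congʳ (+-comm _ _)) ⟩
      1# + ((m × 1# - 1#) - n × 1#)      ≈⟨ +-congˡ (+-assoc _ _ _) ⟩
      1# + (m × 1# + (- 1# - n × 1#))    ≈⟨ sym (+-assoc _ _ _) ⟩
      (1# + m × 1#) + (- 1# - n × 1#)    ≈⟨ +-congˡ (-‿+-comm _ _) ⟩
      (1# + m × 1#) - (1# + n × 1#)      ∎

  ⟦+⟧-homo : ∀ a b → ⟦ a ℤ.+ b ⟧ℤ ≈ ⟦ a ⟧ℤ + ⟦ b ⟧ℤ
  ⟦+⟧-homo -[1+ m ] -[1+ n ] = begin
    - (suc (suc m ℕ.+ n) × 1#)        ≈⟨ -‿cong (trans (1+× (suc m ℕ.+ n) 1#) (+-congˡ (×-homo-+ 1# (suc m) n))) ⟩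
    - (1# + (suc m × 1# + n × 1#))    ≈⟨ -‿cong (trans (sym (+-assoc _ _ _)) (trans (+-congʳ (+-comm _ _)) (+-assoc _ _ _))) ⟩
    - (suc m × 1# + (1# + n × 1#))    ≈⟨ -‿cong (+-congˡ (sym (1+× n 1#))) ⟩
    - (suc m × 1# + suc n × 1#)       ≈⟨ sym (-‿+-comm _ _) ⟩
    - (suc m × 1#) - (suc n × 1#)     ∎
  ⟦+⟧-homo -[1+ m ] (+ n)    = trans (⟦⊖⟧-homo n (suc m)) (+-comm _ _)
  ⟦+⟧-homo (+ m)    -[1+ n ] = ⟦⊖⟧-homo m (suc n)
  ⟦+⟧-homo (+ m)    (+ n)    = ×-homo-+ 1# m n

  ⟦+◃⟧ : ∀ k → ⟦ Sign.+ ℤ.◃ k ⟧ℤ ≈ k × 1#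
  ⟦+◃⟧ k = reflexive (P.cong ⟦_⟧ℤ (ℤP.+◃n≡+n k))

  ⟦-◃⟧ : ∀ k → ⟦ Sign.- ℤ.◃ k ⟧ℤ ≈ - (k × 1#)
  ⟦-◃⟧ k = trans (reflexive (P.cong ⟦_⟧ℤ (ℤP.-◃n≡-n k))) (⟦-⟧-homo (+ k))

  ⟦*⟧-homo : ∀ a b → ⟦ a ℤ.* b ⟧ℤ ≈ ⟦ a ⟧ℤ * ⟦ b ⟧ℤ
  ⟦*⟧-homo (+ m)    (+ n)    = trans (⟦+◃⟧ (m ℕ.* n)) (×1-homo-* m n)
  ⟦*⟧-homo (+ m)    -[1+ n ] =
    trans (⟦-◃⟧ (m ℕ.* suc n)) (trans (-‿cong (×1-homo-* m (suc n))) (-‿distribʳ-* _ _))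
  ⟦*⟧-homo -[1+ m ] (+ n)    =
    trans (⟦-◃⟧ (suc m ℕ.* n)) (trans (-‿cong (×1-homo-* (suc m) n)) (-‿distribˡ-* _ _))
  ⟦*⟧-homo -[1+ m ] -[1+ n ] =
    trans (⟦+◃⟧ (suc m ℕ.* suc n)) (trans (×1-homo-* (suc m) (suc n))
      (trans (sym (-‿involutive _)) (trans (-‿cong (-‿distribˡ-* _ _)) (-‿distribʳ-* _ _))))

  ⟦_⟧ℤ-morphism : ℤ.+-*-rawRing -Raw-AlmostCommutative⟶ fromCommutativeRing CR
  ⟦_⟧ℤ-morphism = record
    { ⟦_⟧ = ⟦_⟧ℤ ; +-homo = ⟦+⟧-homo ; *-homo = ⟦*⟧-homo ; -‿homo = ⟦-⟧-homo
    ; 0-homo = refl ; 1-homo = refl }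

  ⟦⟧ℤ-equal? : ∀ a b → Maybe (⟦ a ⟧ℤ ≈ ⟦ b ⟧ℤ)
  ⟦⟧ℤ-equal? a b with a ℤ.≟ b
  ... | yes a≡b = just (reflexive (P.cong ⟦_⟧ℤ a≡b))
  ... | no _    = nothing

  open RingSolver ℤ.+-*-rawRing (fromCommutativeRing CR) ⟦_⟧ℤ-morphism ⟦⟧ℤ-equal? public

module _ {c ℓ : Level} (R : CommutativeRing c ℓ) where
  open CommutativeRing R
  open Series R
  module ≈-Reasoning = SetoidReasoning setoid
  open RingProperties ring using (-0#≈0#; -‿+-comm; -‿involutive)

  Σ-cong : ∀ n {f g : ℕ → Carrier} → (∀ i → i < n → f i ≈ g i) → Σ< n f ≈ Σ< n g
  Σ-cong zero    f≈g = refl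
  Σ-cong (suc n) f≈g = +-cong (Σ-cong n (λ i i<n → f≈g i (NP.m<n⇒m<1+n i<n))) (f≈g n NP.≤-refl)

  Σ-cong′ : ∀ n {f g : ℕ → Carrier} → (∀ i → f i ≈ g i) → Σ< n f ≈ Σ< n g
  Σ-cong′ n f≈g = Σ-cong n (λ i _ → f≈g i)

  Σ-≡ : ∀ {m n} (f : ℕ → Carrier) → m ≡ n → Σ< m f ≈ Σ< n f
  Σ-≡ f P.refl = refl

  Σ-+ : ∀ n (f g : ℕ → Carrier) → Σ< n (λ i → f i + g i) ≈ Σ< n f + Σ< n g
  Σ-+ zero    f g = sym (+-identityˡ _)
  Σ-+ (suc n) f g = begin
    Σ< n (λ i → f i + g i) + (f n + g n)  ≈⟨ +-congʳ (Σ-+ n f g) ⟩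
    (Σ< n f + Σ< n g) + (f n + g n)       ≈⟨ +-assoc _ _ _ ⟩
    Σ< n f + (Σ< n g + (f n + g n))       ≈⟨ +-congˡ (sym (+-assoc _ _ _)) ⟩
    Σ< n f + ((Σ< n g + f n) + g n)       ≈⟨ +-congˡ (+-congʳ (+-comm _ _)) ⟩
    Σ< n f + ((f n + Σ< n g) + g n)       ≈⟨ +-congˡ (+-assoc _ _ _) ⟩
    Σ< n f + (f n + (Σ< n g + g n))       ≈⟨ sym (+-assoc _ _ _) ⟩
    (Σ< n f + f n) + (Σ< n g + g n)       ∎
    where open ≈-Reasoning

  Σ-*ˡ : ∀ n a (f : ℕ → Carrier) → a * Σ< n f ≈ Σ< n (λ i → a * f i)
  Σ-*ˡ zero    a f = zeroʳ a
  Σ-*ˡ (suc n) a f = trans (distribˡ _ _ _) (+-congʳ (Σ-*ˡ n a f))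

  Σ-*ʳ : ∀ n a (f : ℕ → Carrier) → Σ< n f * a ≈ Σ< n (λ i → f i * a)
  Σ-*ʳ n a f = trans (*-comm _ _) (trans (Σ-*ˡ n a f) (Σ-cong′ n (λ i → *-comm _ _)))

  Σ-0 : ∀ n (f : ℕ → Carrier) → (∀ i → i < n → f i ≈ 0#) → Σ< n f ≈ 0#
  Σ-0 n f f≈0 = trans (Σ-cong n f≈0) (Σ-zeros n)
    where
    Σ-zeros : ∀ n → Σ< n (λ _ → 0#) ≈ 0#
    Σ-zeros zero    = refl
    Σ-zeros (suc n) = trans (+-identityʳ _) (Σ-zeros n)

  Σ-front : ∀ n (f : ℕ → Carrier) → Σ< (suc n) f ≈ f 0 + Σ< n (λ i → f (suc i))
  Σ-front zero    f = trans (+-identityˡ _) (sym (+-identityʳ _))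
  Σ-front (suc n) f = trans (+-congʳ (Σ-front n f)) (+-assoc _ _ _)

  Σ-split : ∀ m n (f : ℕ → Carrier) → Σ< (m ℕ.+ n) f ≈ Σ< m f + Σ< n (λ i → f (m ℕ.+ i))
  Σ-split m zero    f = trans (Σ-≡ f (NP.+-identityʳ m)) (sym (+-identityʳ _))
  Σ-split m (suc n) f = begin
    Σ< (m ℕ.+ suc n) f                                   ≈⟨ Σ-≡ f (NP.+-suc m n) ⟩
    Σ< (m ℕ.+ n) f + f (m ℕ.+ n)                         ≈⟨ +-congʳ (Σ-split m n f) ⟩
    (Σ< m f + Σ< n (λ i → f (m ℕ.+ i))) + f (m ℕ.+ n)    ≈⟨ +-assoc _ _ _ ⟩
    Σ< m f + Σ< (suc n) (λ i → f (m ℕ.+ i))              ∎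
    where open ≈-Reasoning

  Σ-pad : ∀ m n (f : ℕ → Carrier) → m ≤ n → (∀ i → m ≤ i → i < n → f i ≈ 0#) → Σ< n f ≈ Σ< m f
  Σ-pad m n f m≤n f≈0 = begin
    Σ< n f                                     ≈⟨ Σ-≡ f (P.sym (NP.m+[n∸m]≡n m≤n)) ⟩
    Σ< (m ℕ.+ (n ∸ m)) f                       ≈⟨ Σ-split m (n ∸ m) f ⟩
    Σ< m f + Σ< (n ∸ m) (λ i → f (m ℕ.+ i))    ≈⟨ +-congˡ (Σ-0 (n ∸ m) _ tail≈0) ⟩
    Σ< m f + 0#                                ≈⟨ +-identityʳ _ ⟩
    Σ< m f                                     ∎
    where
    open ≈-Reasoning
    tail≈0 : ∀ i → i < n ∸ m → f (m ℕ.+ i) ≈ 0#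
    tail≈0 i i<n∸m = f≈0 (m ℕ.+ i) (NP.m≤m+n m i)
      (P.subst (m ℕ.+ i <_) (NP.m+[n∸m]≡n m≤n) (NP.+-monoʳ-< m i<n∸m))

  Σ-reverse : ∀ n (f : ℕ → Carrier) → Σ< n f ≈ Σ< n (λ i → f (n ∸ suc i))
  Σ-reverse zero    f = refl
  Σ-reverse (suc n) f = begin
    Σ< n f + f n                          ≈⟨ +-comm _ _ ⟩
    f n + Σ< n f                          ≈⟨ +-congˡ (Σ-reverse n f) ⟩
    f n + Σ< n (λ i → f (n ∸ suc i))      ≈⟨ sym (Σ-front n _) ⟩
    Σ< (suc n) (λ i → f (suc n ∸ suc i))  ∎
    where open ≈-Reasoning

  Σ-swap : ∀ m n (F : ℕ → ℕ → Carrier) →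
           Σ< m (λ i → Σ< n (λ j → F i j)) ≈ Σ< n (λ j → Σ< m (λ i → F i j))
  Σ-swap zero    n F = sym (Σ-0 n _ (λ _ _ → refl))
  Σ-swap (suc m) n F = trans (+-congʳ (Σ-swap m n F)) (sym (Σ-+ n _ _))

  when : ∀ {p} {A : Set p} → Dec A → Carrier → Carrier
  when (yes _) a = a
  when (no _)  a = 0#

  Σ-triangle : ∀ n (F : ℕ → ℕ → Carrier) →
    Σ< n (λ i → Σ< (suc i) (λ j → F j i)) ≈ Σ< n (λ j → Σ< (n ∸ j) (λ t → F j (j ℕ.+ t)))
  Σ-triangle n F = begin
    Σ< n (λ i → Σ< (suc i) (λ j → F j i))            ≈⟨ Σ-cong n square-column ⟩
    Σ< n (λ i → Σ< n (λ j → G j i))                  ≈⟨ Σ-swap n n _ ⟩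
    Σ< n (λ j → Σ< n (λ i → G j i))                  ≈⟨ Σ-cong n (λ j j<n → square-row j (NP.<⇒≤ j<n)) ⟩
    Σ< n (λ j → Σ< (n ∸ j) (λ t → F j (j ℕ.+ t)))    ∎
    where
    open ≈-Reasoning
    G : ℕ → ℕ → Carrier
    G j i = when (j ≤? i) (F j i)
    G-below : ∀ j i → i < j → G j i ≈ 0#
    G-below j i i<j with j ≤? i
    ... | yes j≤i = ⊥-elim (NP.<⇒≱ i<j j≤i)
    ... | no _    = refl
    G-above : ∀ j i → j ≤ i → G j i ≈ F j i
    G-above j i j≤i with j ≤? i
    ... | yes _   = refl
    ... | no j≰i  = ⊥-elim (j≰i j≤i)
    square-column : ∀ i → i < n → Σ< (suc i) (λ j → F j i) ≈ Σ< n (λ j → G j i)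
    square-column i i<n = trans (Σ-cong (suc i) (λ j j≤i → sym (G-above j i (NP.≤-pred j≤i))))
      (sym (Σ-pad (suc i) n (λ j → G j i) i<n (λ j i<j _ → G-below j i i<j)))
    square-row : ∀ j → j ≤ n → Σ< n (λ i → G j i) ≈ Σ< (n ∸ j) (λ t → F j (j ℕ.+ t))
    square-row j j≤n = begin
      Σ< n (λ i → G j i)                                           ≈⟨ Σ-≡ _ (P.sym (NP.m+[n∸m]≡n j≤n)) ⟩
      Σ< (j ℕ.+ (n ∸ j)) (λ i → G j i)                             ≈⟨ Σ-split j (n ∸ j) _ ⟩
      Σ< j (λ i → G j i) + Σ< (n ∸ j) (λ t → G j (j ℕ.+ t))        ≈⟨ +-cong (Σ-0 j _ (G-below j))
                                                                         (Σ-cong′ (n ∸ j) (λ t → G-above j _ (NP.m≤m+n j t))) ⟩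
      0# + Σ< (n ∸ j) (λ t → F j (j ℕ.+ t))                        ≈⟨ +-identityˡ _ ⟩
      Σ< (n ∸ j) (λ t → F j (j ℕ.+ t))                             ∎

  infix 4 _≋_
  _≋_ : PS → PS → Set ℓ
  f ≋ g = ∀ n → f n ≈ g n

  zeroS : PS
  zeroS _ = 0#

  negS : PS → PS
  negS f n = - f n

  ⊛-cong : ∀ {f f′ g g′} → f ≋ f′ → g ≋ g′ → (f ⊛ g) ≋ (f′ ⊛ g′)
  ⊛-cong f≋f′ g≋g′ n = Σ-cong′ (suc n) (λ i → *-cong (f≋f′ i) (g≋g′ (n ∸ i)))

  ⊛-comm : ∀ f g → (f ⊛ g) ≋ (g ⊛ f)
  ⊛-comm f g n = begin
    Σ< (suc n) (λ i → f i * g (n ∸ i))               ≈⟨ Σ-reverse (suc n) _ ⟩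
    Σ< (suc n) (λ i → f (n ∸ i) * g (n ∸ (n ∸ i)))   ≈⟨ Σ-cong (suc n) (λ i i≤n → trans (*-comm _ _)
                                                          (*-congʳ (reflexive (P.cong g (NP.m∸[m∸n]≡n (NP.≤-pred i≤n)))))) ⟩
    Σ< (suc n) (λ i → g i * f (n ∸ i))               ∎
    where open ≈-Reasoning

  ⊛-assoc : ∀ f g h → ((f ⊛ g) ⊛ h) ≋ (f ⊛ (g ⊛ h))
  ⊛-assoc f g h n = begin
    Σ< (suc n) (λ i → Σ< (suc i) (λ j → f j * g (i ∸ j)) * h (n ∸ i))
      ≈⟨ Σ-cong′ (suc n) (λ i → Σ-*ʳ (suc i) _ _) ⟩
    Σ< (suc n) (λ i → Σ< (suc i) (λ j → f j * g (i ∸ j) * h (n ∸ i)))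
      ≈⟨ Σ-triangle (suc n) (λ j i → f j * g (i ∸ j) * h (n ∸ i)) ⟩
    Σ< (suc n) (λ j → Σ< (suc n ∸ j) (λ t → f j * g ((j ℕ.+ t) ∸ j) * h (n ∸ (j ℕ.+ t))))
      ≈⟨ Σ-cong (suc n) (λ j j≤n → row j (NP.≤-pred j≤n)) ⟩
    Σ< (suc n) (λ j → f j * Σ< (suc (n ∸ j)) (λ t → g t * h ((n ∸ j) ∸ t)))
      ∎
    where
    open ≈-Reasoning
    row : ∀ j → j ≤ n → Σ< (suc n ∸ j) (λ t → f j * g ((j ℕ.+ t) ∸ j) * h (n ∸ (j ℕ.+ t)))
                      ≈ f j * Σ< (suc (n ∸ j)) (λ t → g t * h ((n ∸ j) ∸ t))
    row j j≤n = begin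
      Σ< (suc n ∸ j) (λ t → f j * g ((j ℕ.+ t) ∸ j) * h (n ∸ (j ℕ.+ t)))
        ≈⟨ Σ-≡ _ (NP.+-∸-assoc 1 j≤n) ⟩
      Σ< (suc (n ∸ j)) (λ t → f j * g ((j ℕ.+ t) ∸ j) * h (n ∸ (j ℕ.+ t)))
        ≈⟨ Σ-cong′ (suc (n ∸ j)) (λ t → trans (*-assoc _ _ _) (*-congˡ (*-cong
             (reflexive (P.cong g (NP.m+n∸m≡n j t))) (reflexive (P.cong h (P.sym (NP.∸-+-assoc n j t))))))) ⟩
      Σ< (suc (n ∸ j)) (λ t → f j * (g t * h ((n ∸ j) ∸ t)))
        ≈⟨ sym (Σ-*ˡ (suc (n ∸ j)) (f j) _) ⟩
      f j * Σ< (suc (n ∸ j)) (λ t → g t * h ((n ∸ j) ∸ t))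
        ∎

  ⊛-distribˡ : ∀ f g h → (f ⊛ (g ⊕ h)) ≋ ((f ⊛ g) ⊕ (f ⊛ h))
  ⊛-distribˡ f g h n = trans (Σ-cong′ (suc n) (λ i → distribˡ _ _ _)) (Σ-+ (suc n) _ _)

  ⊛-distribʳ : ∀ f g h → ((g ⊕ h) ⊛ f) ≋ ((g ⊛ f) ⊕ (h ⊛ f))
  ⊛-distribʳ f g h n = trans (Σ-cong′ (suc n) (λ i → distribʳ _ _ _)) (Σ-+ (suc n) _ _)

  mono-same : ∀ e → mono e e ≈ 1#
  mono-same e with e ≡ᵇ e | NP.≡⇒≡ᵇ e e P.refl
  ... | true | _ = refl

  mono-diff : ∀ e n → ¬ e ≡ n → mono e n ≈ 0#
  mono-diff e n e≢n with e ≡ᵇ n in eq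
  ... | true  = ⊥-elim (e≢n (NP.≡ᵇ⇒≡ e n (P.subst T (P.sym eq) _)))
  ... | false = refl

  Σ-δ : ∀ n e (h : ℕ → Carrier) → Σ< n (λ i → mono e i * h i) ≈ when (e ℕ.<? n) (h e)
  Σ-δ zero    e h = refl
  Σ-δ (suc n) e h with e ℕ.<? n | e ℕ.<? suc n | Σ-δ n e h
  ... | yes e<n  | yes _     | ih = trans (+-cong ih (trans (*-congʳ (mono-diff e n (λ e≡n → NP.<-irrefl e≡n e<n)))
                                        (zeroˡ _))) (+-identityʳ _)
  ... | yes e<n  | no e≮1+n  | ih = ⊥-elim (e≮1+n (NP.m<n⇒m<1+n e<n))
  ... | no e≮n   | yes e<1+n | ih with NP.≤∧≮⇒≡ (NP.≤-pred e<1+n) e≮n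
  ...   | P.refl = trans (+-cong ih (trans (*-congʳ (mono-same e)) (*-identityˡ _))) (+-identityˡ _)
  Σ-δ (suc n) e h | no e≮n | no e≮1+n | ih = trans (+-cong ih (trans (*-congʳ
                      (mono-diff e n (λ { P.refl → e≮1+n NP.≤-refl }))) (zeroˡ _))) (+-identityʳ _)

  mono-⊛ : ∀ e g n → (mono e ⊛ g) n ≈ when (e ℕ.<? suc n) (g (n ∸ e))
  mono-⊛ e g n = Σ-δ (suc n) e (λ i → g (n ∸ i))

  mono-⊛-below : ∀ e g n → n < e → (mono e ⊛ g) n ≈ 0#
  mono-⊛-below e g n n<e with e ℕ.<? suc n | mono-⊛ e g n
  ... | yes e≤n | _ = ⊥-elim (NP.<⇒≱ n<e (NP.≤-pred e≤n))
  ... | no _    | r = r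

  mono-⊛-shift : ∀ e g n → (mono e ⊛ g) (e ℕ.+ n) ≈ g n
  mono-⊛-shift e g n with e ℕ.<? suc (e ℕ.+ n) | mono-⊛ e g (e ℕ.+ n)
  ... | yes _  | r = trans r (reflexive (P.cong g (NP.m+n∸m≡n e n)))
  ... | no e≰  | _ = ⊥-elim (e≰ (s≤s (NP.m≤m+n e n)))

  oneS-⊛ : ∀ g → (oneS ⊛ g) ≋ g
  oneS-⊛ g = mono-⊛-shift 0 g

  mono-+ : ∀ a b → (mono a ⊛ mono b) ≋ mono (a ℕ.+ b)
  mono-+ a b n with a ℕ.<? suc n
  ... | yes a≤n = begin
    (mono a ⊛ mono b) n                ≡⟨ P.cong (mono a ⊛ mono b) (P.sym n≡a+[n∸a]) ⟩
    (mono a ⊛ mono b) (a ℕ.+ (n ∸ a))  ≈⟨ mono-⊛-shift a (mono b) (n ∸ a) ⟩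
    mono b (n ∸ a)                     ≈⟨ shifted ⟩
    mono (a ℕ.+ b) n                   ∎
    where
    open ≈-Reasoning
    n≡a+[n∸a] : a ℕ.+ (n ∸ a) ≡ n
    n≡a+[n∸a] = NP.m+[n∸m]≡n (NP.≤-pred a≤n)
    shifted : mono b (n ∸ a) ≈ mono (a ℕ.+ b) n
    shifted with b ℕ.≟ (n ∸ a)
    ... | yes P.refl = trans (mono-same b)
                         (sym (trans (reflexive (P.cong (mono (a ℕ.+ b)) (P.sym n≡a+[n∸a]))) (mono-same (a ℕ.+ b))))
    ... | no b≢n∸a = trans (mono-diff b (n ∸ a) b≢n∸a)
                       (sym (mono-diff (a ℕ.+ b) n (λ a+b≡n → b≢n∸a (P.trans (P.sym (NP.m+n∸m≡n a b)) (P.cong (_∸ a) a+b≡n)))))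
  ... | no a≰n = trans (mono-⊛-below a (mono b) n (NP.≰⇒> (λ a≤n → a≰n (s≤s a≤n))))
                   (sym (mono-diff (a ℕ.+ b) n (λ a+b≡n → a≰n (s≤s (P.subst (a ≤_) a+b≡n (NP.m≤m+n a b))))))

  seriesRing : CommutativeRing c ℓ
  seriesRing = record { isCommutativeRing = isCR }
    where
    isCR : IsCommutativeRing _≋_ _⊕_ _⊛_ negS zeroS oneS
    isCR = record
      { isRing = record
        { +-isAbelianGroup = record
          { isGroup = record
            { isMonoid = record
              { isSemigroup = record
                { isMagma = record
                  { isEquivalence = record
                    { refl = λ n → refl ; sym = λ e n → sym (e n) ; trans = λ e e′ n → trans (e n) (e′ n) }
                  ; ∙-cong = λ e e′ n → +-cong (e n) (e′ n) }
                ; assoc = λ f g h n → +-assoc _ _ _ }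
              ; identity = (λ f n → +-identityˡ _) , (λ f n → +-identityʳ _) }
            ; inverse = (λ f n → -‿inverseˡ _) , (λ f n → -‿inverseʳ _)
            ; ⁻¹-cong = λ e n → -‿cong (e n) }
          ; comm = λ f g n → +-comm _ _ }
        ; *-cong = ⊛-cong
        ; *-assoc = ⊛-assoc
        ; *-identity = oneS-⊛ , (λ g n → trans (⊛-comm g oneS n) (oneS-⊛ g n))
        ; distrib = ⊛-distribˡ , ⊛-distribʳ }
      ; *-comm = ⊛-comm }

  module ≋ = CommutativeRing seriesRing
  module ≋-Reasoning = SetoidReasoning ≋.setoid
  module SeriesSolver = IntegerRingSolver seriesRing

  1ₑ : ∀ {k} → SeriesSolver.Polynomial k
  1ₑ = SeriesSolver.con (+ 1)

  ΣS-cong : ∀ n {F G : ℕ → PS} → (∀ i → i < n → F i ≋ G i) → ΣS< n F ≋ ΣS< n G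
  ΣS-cong n F≋G m = Σ-cong n (λ i i<n → F≋G i i<n m)

  ΣS-≡ : ∀ {m n} F → m ≡ n → ΣS< m F ≋ ΣS< n F
  ΣS-≡ F P.refl = ≋.refl

  ΣS-front : ∀ n F → ΣS< (suc n) F ≋ (F 0 ⊕ ΣS< n (λ j → F (suc j)))
  ΣS-front n F m = Σ-front n (λ i → F i m)

  ΣS-+ : ∀ n F G → ΣS< n (λ i → F i ⊕ G i) ≋ (ΣS< n F ⊕ ΣS< n G)
  ΣS-+ n F G m = Σ-+ n (λ i → F i m) (λ i → G i m)

  ΣS-pad : ∀ m n F → m ≤ n → (∀ i → m ≤ i → i < n → F i ≋ zeroS) → ΣS< n F ≋ ΣS< m F
  ΣS-pad m n F m≤n F≋0 k = Σ-pad m n (λ i → F i k) m≤n (λ i m≤i i<n → F≋0 i m≤i i<n k)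

  ΣS-triangle : ∀ n (F : ℕ → ℕ → PS) →
    ΣS< n (λ i → ΣS< (suc i) (λ j → F j i)) ≋ ΣS< n (λ j → ΣS< (n ∸ j) (λ t → F j (j ℕ.+ t)))
  ΣS-triangle n F k = Σ-triangle n (λ j i → F j i k)

  ΣS-⊛ : ∀ n (F : ℕ → PS) g → (ΣS< n F ⊛ g) ≋ ΣS< n (λ i → F i ⊛ g)
  ΣS-⊛ zero    F g m = Σ-0 (suc m) _ (λ i _ → zeroˡ _)
  ΣS-⊛ (suc n) F g m = trans (⊛-distribʳ g (ΣS< n F) (F n) m) (+-congʳ (ΣS-⊛ n F g m))

  ⊛-ΣS : ∀ n f F → (f ⊛ ΣS< n F) ≋ ΣS< n (λ i → f ⊛ F i)
  ⊛-ΣS n f F = ≋.trans (≋.*-comm f (ΣS< n F)) (≋.trans (ΣS-⊛ n F f) (ΣS-cong n (λ i _ → ≋.*-comm (F i) f)))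

  ⊛-zeroS : ∀ f {g} → g ≋ zeroS → (f ⊛ g) ≋ zeroS
  ⊛-zeroS f g≋0 = ≋.trans (≋.*-congˡ {f} g≋0) (≋.zeroʳ f)

  mono-≡ : ∀ {a b} → a ≡ b → mono a ≋ mono b
  mono-≡ P.refl = ≋.refl

  infix 4 _≈[_]_
  _≈[_]_ : PS → ℕ → PS → Set ℓ
  f ≈[ N ] g = ∀ n → n ≤ N → f n ≈ g n

  ≈[]-refl : ∀ {N f} → f ≈[ N ] f
  ≈[]-refl n _ = refl

  ≈[]-sym : ∀ {N f g} → f ≈[ N ] g → g ≈[ N ] f
  ≈[]-sym f≈g n n≤N = sym (f≈g n n≤N)

  ≈[]-trans : ∀ {N f g h} → f ≈[ N ] g → g ≈[ N ] h → f ≈[ N ] h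
  ≈[]-trans f≈g g≈h n n≤N = trans (f≈g n n≤N) (g≈h n n≤N)

  ≋⇒≈[] : ∀ {N f g} → f ≋ g → f ≈[ N ] g
  ≋⇒≈[] f≋g n _ = f≋g n

  ≈[]-weaken : ∀ {N M f g} → M ≤ N → f ≈[ N ] g → f ≈[ M ] g
  ≈[]-weaken M≤N f≈g n n≤M = f≈g n (NP.≤-trans n≤M M≤N)

  ≈[]-⊛ : ∀ {N f f′ g g′} → f ≈[ N ] f′ → g ≈[ N ] g′ → (f ⊛ g) ≈[ N ] (f′ ⊛ g′)
  ≈[]-⊛ f≈f′ g≈g′ n n≤N = Σ-cong (suc n) (λ i i≤n →
    *-cong (f≈f′ i (NP.≤-trans (NP.≤-pred i≤n) n≤N)) (g≈g′ (n ∸ i) (NP.≤-trans (NP.m∸n≤m n i) n≤N)))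

  ≈[]-ΣS : ∀ {N} L {F G : ℕ → PS} → (∀ i → i < L → F i ≈[ N ] G i) → ΣS< L F ≈[ N ] ΣS< L G
  ≈[]-ΣS L F≈G n n≤N = Σ-cong L (λ i i<L → F≈G i i<L n n≤N)

  vanish : ℕ → PS → Set ℓ
  vanish v f = ∀ n → n < v → f n ≈ 0#

  vanish⇒≈[]0 : ∀ {N f} → vanish (suc N) f → f ≈[ N ] zeroS
  vanish⇒≈[]0 f-vanish n n≤N = f-vanish n (s≤s n≤N)

  vanish-weaken : ∀ {a b f} → a ≤ b → vanish b f → vanish a f
  vanish-weaken a≤b f-vanish n n<a = f-vanish n (NP.<-≤-trans n<a a≤b)

  vanish-≋ : ∀ {v f g} → f ≋ g → vanish v f → vanish v g
  vanish-≋ f≋g f-vanish n n<v = trans (sym (f≋g n)) (f-vanish n n<v)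

  vanish-mono : ∀ e g → vanish e (mono e ⊛ g)
  vanish-mono e g n n<e = mono-⊛-below e g n n<e

  vanish-⊛ : ∀ a b f g → vanish a f → vanish b g → vanish (a ℕ.+ b) (f ⊛ g)
  vanish-⊛ a b f g f-vanish g-vanish n n<a+b = Σ-0 (suc n) _ summand≈0
    where
    summand≈0 : ∀ i → i < suc n → f i * g (n ∸ i) ≈ 0#
    summand≈0 i i≤n with i ℕ.<? a
    ... | yes i<a = trans (*-congʳ (f-vanish i i<a)) (zeroˡ _)
    ... | no i≮a  = trans (*-congˡ (g-vanish (n ∸ i) n∸i<b)) (zeroʳ _)
      where
      n∸i<b : n ∸ i < b
      n∸i<b = NP.+-cancelˡ-< i (n ∸ i) b (P.subst (_< i ℕ.+ b) (P.sym (NP.m+[n∸m]≡n (NP.≤-pred i≤n)))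
                (NP.<-≤-trans n<a+b (NP.+-monoˡ-≤ b (NP.≮⇒≥ i≮a))))

  vanish-⊛ʳ : ∀ a f g → vanish a f → vanish a (f ⊛ g)
  vanish-⊛ʳ a f g f-vanish =
    P.subst (λ k → vanish k (f ⊛ g)) (NP.+-identityʳ a) (vanish-⊛ a 0 f g f-vanish (λ n ()))

  vanish-⊛ˡ : ∀ a f g → vanish a g → vanish a (f ⊛ g)
  vanish-⊛ˡ a f g g-vanish = vanish-≋ (⊛-comm g f) (vanish-⊛ʳ a g f g-vanish)

  module _ (f : PS) (f₀≈1 : f 0 ≈ 1#) where
    private
      g : PS
      g = oneS ⊖ f

      g-vanish : vanish 1 g
      g-vanish zero _ = trans (+-congˡ (-‿cong f₀≈1)) (-‿inverseʳ _)
      g-vanish (suc n) (s≤s ())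

      powS-vanish : ∀ j → vanish j (powS g j)
      powS-vanish zero    n ()
      powS-vanish (suc j) = P.subst (λ k → vanish k (powS g (suc j))) (NP.+-comm j 1)
                              (vanish-⊛ j 1 _ _ (powS-vanish j) g-vanish)

      geometric : ℕ → PS
      geometric M = ΣS< M (powS g)

      geometric-⊛ : ∀ M → (geometric M ⊛ (oneS ⊖ g)) ≋ (oneS ⊖ powS g M)
      geometric-⊛ zero    n = trans (Σ-0 (suc n) _ (λ i _ → zeroˡ _)) (sym (-‿inverseʳ _))
      geometric-⊛ (suc M) = begin
        (geometric M ⊕ powS g M) ⊛ (oneS ⊖ g)                    ≈⟨ ⊛-distribʳ (oneS ⊖ g) (geometric M) (powS g M) ⟩
        (geometric M ⊛ (oneS ⊖ g)) ⊕ (powS g M ⊛ (oneS ⊖ g))     ≈⟨ ≋.+-congʳ (geometric-⊛ M) ⟩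
        (oneS ⊖ powS g M) ⊕ (powS g M ⊛ (oneS ⊖ g))              ≈⟨ solve 2 (λ p q → (1ₑ :- p) :+ (p :* (1ₑ :- q)) := 1ₑ :- p :* q)
                                                                        ≋.refl (powS g M) g ⟩
        oneS ⊖ (powS g M ⊛ g)                                    ∎
        where
        open ≋-Reasoning
        open SeriesSolver using (solve; _:+_; _:*_; _:-_; _:=_)

      f≋1-g : f ≋ (oneS ⊖ g)
      f≋1-g n = sym (trans (+-congˡ (sym (-‿+-comm _ _))) (trans (sym (+-assoc _ _ _))
                  (trans (+-congʳ (-‿inverseʳ _)) (trans (+-identityˡ _) (-‿involutive _)))))

      invS≈geometric : ∀ N → invS f ≈[ N ] geometric (suc N)
      invS≈geometric N n n≤N =
        sym (Σ-pad (suc n) (suc N) _ (s≤s n≤N) (λ j n<j _ → powS-vanish j n n<j))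

    invS-inverse : (invS f ⊛ f) ≋ oneS
    invS-inverse N = begin
      (invS f ⊛ f) N                       ≈⟨ ≈[]-⊛ (invS≈geometric N) (≋⇒≈[] f≋1-g) N NP.≤-refl ⟩
      (geometric (suc N) ⊛ (oneS ⊖ g)) N   ≈⟨ geometric-⊛ (suc N) N ⟩
      oneS N - powS g (suc N) N            ≈⟨ +-congˡ (trans (-‿cong (powS-vanish (suc N) N NP.≤-refl)) -0#≈0#) ⟩
      oneS N + 0#                          ≈⟨ +-identityʳ _ ⟩
      oneS N                               ∎
      where open ≈-Reasoning

  ≈[]-powS : ∀ {N f f′} → f ≈[ N ] f′ → ∀ j → powS f j ≈[ N ] powS f′ j
  ≈[]-powS f≈f′ zero    n _ = refl
  ≈[]-powS f≈f′ (suc j) = ≈[]-⊛ (≈[]-powS f≈f′ j) f≈f′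

  ≈[]-invS : ∀ {N f f′} → f ≈[ N ] f′ → invS f ≈[ N ] invS f′
  ≈[]-invS {N} {f} {f′} f≈f′ n n≤N = Σ-cong′ (suc n) (λ j → ≈[]-powS 1-f≈1-f′ j n n≤N)
    where
    1-f≈1-f′ : (oneS ⊖ f) ≈[ N ] (oneS ⊖ f′)
    1-f≈1-f′ m m≤N = +-congˡ (-‿cong (f≈f′ m m≤N))

  ⊛-transpose : ∀ {a b u u′} → (u′ ⊛ u) ≋ oneS → (a ⊛ u) ≋ b → a ≋ (b ⊛ u′)
  ⊛-transpose {a} {b} {u} {u′} u′u≋1 au≋b = begin
    a              ≈⟨ ≋.sym (≋.*-identityʳ a) ⟩
    a ⊛ oneS       ≈⟨ ≋.*-congˡ {a} (≋.sym u′u≋1) ⟩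
    a ⊛ (u′ ⊛ u)   ≈⟨ ≋.*-congˡ {a} (≋.*-comm u′ u) ⟩
    a ⊛ (u ⊛ u′)   ≈⟨ ≋.sym (≋.*-assoc a u u′) ⟩
    (a ⊛ u) ⊛ u′   ≈⟨ ≋.*-congʳ {u′} au≋b ⟩
    b ⊛ u′         ∎
    where open ≋-Reasoning

  1-q^ : ℕ → PS
  1-q^ e = oneS ⊖ mono e

  1-q^-≡ : ∀ {a b} → a ≡ b → 1-q^ a ≋ 1-q^ b
  1-q^-≡ P.refl = ≋.refl

  1-q^≈[]1 : ∀ e N → N < e → 1-q^ e ≈[ N ] oneS
  1-q^≈[]1 e N N<e n n≤N =
    trans (+-congˡ (trans (-‿cong (mono-diff e n (λ e≡n → NP.<-irrefl (P.sym e≡n) (NP.≤-<-trans n≤N N<e))))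
      -0#≈0#)) (+-identityʳ _)

  qp2-≡ : ∀ {a b} → a ≡ b → qp2 a ≋ qp2 b
  qp2-≡ P.refl = ≋.refl

  qp2-constant : ∀ n → qp2 n 0 ≈ 1#
  qp2-constant zero    = refl
  qp2-constant (suc n) = trans (+-identityˡ _) (trans (*-cong (qp2-constant n) 1-q^[2+2n]₀≈1) (*-identityˡ _))
    where
    1-q^[2+2n]₀≈1 : 1-q^ (2 ℕ.* suc n) 0 ≈ 1#
    1-q^[2+2n]₀≈1 = 1-q^≈[]1 (2 ℕ.* suc n) 0 (s≤s z≤n) 0 z≤n

  qp2⁻¹ : ℕ → PS
  qp2⁻¹ n = invS (qp2 n)

  qp2⁻¹-≡ : ∀ {a b} → a ≡ b → qp2⁻¹ a ≋ qp2⁻¹ b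
  qp2⁻¹-≡ P.refl = ≋.refl

  qp2⁻¹-inverse : ∀ n → (qp2⁻¹ n ⊛ qp2 n) ≋ oneS
  qp2⁻¹-inverse n = invS-inverse (qp2 n) (qp2-constant n)

  qp2∞⁻¹ : PS
  qp2∞⁻¹ = invS qp2∞

  qp2∞⁻¹-inverse : (qp2∞⁻¹ ⊛ qp2∞) ≋ oneS
  qp2∞⁻¹-inverse = invS-inverse qp2∞ refl

  qp2-stable-step : ∀ a → qp2 (suc a) ≈[ a ] qp2 a
  qp2-stable-step a = ≈[]-trans (≈[]-⊛ {f = qp2 a} ≈[]-refl (1-q^≈[]1 (2 ℕ.* suc a) a a<2+2a))
                                (≋⇒≈[] (≋.*-identityʳ (qp2 a)))
    where
    a<2+2a : a < 2 ℕ.* suc a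
    a<2+2a = NP.<-≤-trans (NP.n<1+n a) (NP.m≤n*m (suc a) 2)

  qp2-stable : ∀ n d → qp2 (n ℕ.+ d) ≈[ n ] qp2 n
  qp2-stable n zero    = P.subst (λ k → qp2 k ≈[ n ] qp2 n) (P.sym (NP.+-identityʳ n)) ≈[]-refl
  qp2-stable n (suc d) = P.subst (λ k → qp2 k ≈[ n ] qp2 n) (P.sym (NP.+-suc n d))
    (≈[]-trans (≈[]-weaken (NP.m≤m+n n d) (qp2-stable-step (n ℕ.+ d))) (qp2-stable n d))

  qp2≈[]qp2∞ : ∀ a N → N ≤ a → qp2 a ≈[ N ] qp2∞
  qp2≈[]qp2∞ a N N≤a n n≤N = P.subst (λ k → qp2 k n ≈ qp2 n n) (NP.m+[n∸m]≡n (NP.≤-trans n≤N N≤a))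
                                  (qp2-stable n (a ∸ n) n NP.≤-refl)

  qp2⁻¹≈[]qp2∞⁻¹ : ∀ a N → N ≤ a → qp2⁻¹ a ≈[ N ] qp2∞⁻¹
  qp2⁻¹≈[]qp2∞⁻¹ a N N≤a = ≈[]-invS (qp2≈[]qp2∞ a N N≤a)

  qbinom : ℕ → ℕ → PS
  qbinom zero    zero    = oneS
  qbinom zero    (suc i) = zeroS
  qbinom (suc M) zero    = oneS
  qbinom (suc M) (suc i) = qbinom M (suc i) ⊕ (mono (2 ℕ.* (M ∸ i)) ⊛ qbinom M i)

  qbinom-above : ∀ M i → M < i → qbinom M i ≋ zeroS
  qbinom-above zero    (suc i) _         = ≋.refl
  qbinom-above (suc M) (suc i) (s≤s M<i) =
    ≋.trans (≋.+-cong (qbinom-above M (suc i) (NP.m<n⇒m<1+n M<i))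
                      (⊛-zeroS (mono (2 ℕ.* (M ∸ i))) (qbinom-above M i M<i)))
            (≋.+-identityʳ _)

  qbinom-0 : ∀ M → qbinom M 0 ≋ oneS
  qbinom-0 zero    = ≋.refl
  qbinom-0 (suc M) = ≋.refl

  qp2-from : ℕ → ℕ → PS
  qp2-from a zero    = oneS
  qp2-from a (suc l) = qp2-from a l ⊛ 1-q^ (2 ℕ.* (a ℕ.+ suc l))

  qp2-from-≡ : ∀ {a b} l → a ≡ b → qp2-from a l ≋ qp2-from b l
  qp2-from-≡ l P.refl = ≋.refl

  qp2-from-≡ˡ : ∀ a {l l′} → l ≡ l′ → qp2-from a l ≋ qp2-from a l′
  qp2-from-≡ˡ a P.refl = ≋.refl

  chuTerm : ℕ → ℕ → ℕ → PS
  chuTerm M s i = (qbinom M i ⊛ mono (2 ℕ.* (i ℕ.* i ℕ.+ s ℕ.* i))) ⊛ qp2-from (s ℕ.+ i) (M ∸ i)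

  -- Σ_i [M, i]_{q²} q^{2i(i+s)} (q^{2(s+i+1)}; q²)_{M-i}, a q-Chu–Vandermonde sum
  chuSum : ℕ → ℕ → PS
  chuSum M s = ΣS< (suc M) (chuTerm M s)

  private
    chuExp : ℕ → ℕ → ℕ
    chuExp M s = 2 ℕ.* (M ℕ.+ s ℕ.+ 1)

    chuOld : ℕ → ℕ → ℕ → PS
    chuOld M s j = (qbinom M (suc j) ⊛ mono (2 ℕ.* (suc j ℕ.* suc j ℕ.+ s ℕ.* suc j)))
                     ⊛ qp2-from (s ℕ.+ suc j) (M ∸ j)

    chuNew : ℕ → ℕ → ℕ → PS
    chuNew M s j = ((mono (2 ℕ.* (M ∸ j)) ⊛ qbinom M j) ⊛ mono (2 ℕ.* (suc j ℕ.* suc j ℕ.+ s ℕ.* suc j)))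
                     ⊛ qp2-from (s ℕ.+ suc j) (M ∸ j)

    ⊛-move-last : ∀ g m t o → ((g ⊛ m) ⊛ (t ⊛ o)) ≋ (o ⊛ ((g ⊛ m) ⊛ t))
    ⊛-move-last = solve 4 (λ g m t o → (g :* m) :* (t :* o) := o :* ((g :* m) :* t)) ≋.refl
      where open SeriesSolver using (solve; _:*_; _:=_)

    chuTerm-pascal : ∀ M s j → chuTerm (suc M) s (suc j) ≋ (chuOld M s j ⊕ chuNew M s j)
    chuTerm-pascal M s j =
      solve 4 (λ a b m t → ((a :+ b) :* m) :* t := (a :* m) :* t :+ (b :* m) :* t) ≋.refl
        (qbinom M (suc j)) (mono (2 ℕ.* (M ∸ j)) ⊛ qbinom M j)
        (mono (2 ℕ.* (suc j ℕ.* suc j ℕ.+ s ℕ.* suc j))) (qp2-from (s ℕ.+ suc j) (M ∸ j))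
      where open SeriesSolver using (solve; _:+_; _:*_; _:=_)

    chuTerm-head : ∀ M s → chuTerm (suc M) s 0 ≋ (1-q^ (chuExp M s) ⊛ chuTerm M s 0)
    chuTerm-head M s =
      ≋.trans (≋.*-cong (≋.*-congʳ {m₀} (≋.sym (qbinom-0 M)))
                        (≋.*-congˡ {qp2-from (s ℕ.+ 0) M} (1-q^-≡ (P.cong (2 ℕ.*_) (exp≡ s M)))))
              (⊛-move-last (qbinom M 0) m₀ (qp2-from (s ℕ.+ 0) M) (1-q^ (chuExp M s)))
      where
      m₀ = mono (2 ℕ.* (0 ℕ.+ s ℕ.* 0))
      exp≡ : ∀ s M → (s ℕ.+ 0) ℕ.+ suc M ≡ M ℕ.+ s ℕ.+ 1
      exp≡ = solve-∀

    chuOld≋ : ∀ M s j → j < M → chuOld M s j ≋ (1-q^ (chuExp M s) ⊛ chuTerm M s (suc j))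
    chuOld≋ M s j j<M = P.subst (λ M → chuOld M s j ≋ (1-q^ (chuExp M s) ⊛ chuTerm M s (suc j)))
                          (NP.m+[n∸m]≡n j<M) (at (M ∸ suc j))
      where
      at : ∀ d → chuOld (suc j ℕ.+ d) s j ≋ (1-q^ (chuExp (suc j ℕ.+ d) s) ⊛ chuTerm (suc j ℕ.+ d) s (suc j))
      at d = ≋.trans (≋.*-congˡ {qbinom M′ (suc j) ⊛ m}
                (≋.trans (qp2-from-≡ˡ (s ℕ.+ suc j) (M′∸j≡ j))
                (≋.trans (≋.*-congˡ {qp2-from (s ℕ.+ suc j) d} (1-q^-≡ (P.cong (2 ℕ.*_) (exp≡ s j d))))
                         (≋.*-congʳ {1-q^ (chuExp M′ s)} (qp2-from-≡ˡ (s ℕ.+ suc j) (P.sym (NP.m+n∸m≡n j d)))))))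
               (⊛-move-last (qbinom M′ (suc j)) m (qp2-from (s ℕ.+ suc j) (M′ ∸ suc j)) (1-q^ (chuExp M′ s)))
        where
        M′ = suc j ℕ.+ d
        m = mono (2 ℕ.* (suc j ℕ.* suc j ℕ.+ s ℕ.* suc j))
        M′∸j≡ : ∀ j → suc j ℕ.+ d ∸ j ≡ suc d
        M′∸j≡ zero    = P.refl
        M′∸j≡ (suc j) = M′∸j≡ j
        exp≡ : ∀ s j d → (s ℕ.+ suc j) ℕ.+ suc d ≡ (suc j ℕ.+ d) ℕ.+ s ℕ.+ 1
        exp≡ = solve-∀

    chuOld-last : ∀ M s → chuOld M s M ≋ zeroS
    chuOld-last M s = ≋.trans (≋.*-congʳ {qp2-from (s ℕ.+ suc M) (M ∸ M)}
                        (≋.trans (≋.*-congʳ {m} (qbinom-above M (suc M) NP.≤-refl)) (≋.zeroˡ m)))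
                        (≋.zeroˡ (qp2-from (s ℕ.+ suc M) (M ∸ M)))
      where m = mono (2 ℕ.* (suc M ℕ.* suc M ℕ.+ s ℕ.* suc M))

    chuNew≋ : ∀ M s j → j ≤ M → chuNew M s j ≋ (mono (chuExp M s) ⊛ chuTerm M (suc s) j)
    chuNew≋ M s j j≤M = begin
      chuNew M s j
        ≈⟨ solve 4 (λ a g b t → ((a :* g) :* b) :* t := (a :* b) :* (g :* t)) ≋.refl
             (mono (2 ℕ.* (M ∸ j))) (qbinom M j) (mono old) (qp2-from (s ℕ.+ suc j) (M ∸ j)) ⟩
      (mono (2 ℕ.* (M ∸ j)) ⊛ mono old) ⊛ (qbinom M j ⊛ qp2-from (s ℕ.+ suc j) (M ∸ j))
        ≈⟨ ≋.*-cong (≋.trans (mono-+ (2 ℕ.* (M ∸ j)) old) (≋.trans (mono-≡ exp≡) (≋.sym (mono-+ (chuExp M s) new))))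
                    (≋.*-congˡ {qbinom M j} (qp2-from-≡ (M ∸ j) (NP.+-suc s j))) ⟩
      (mono (chuExp M s) ⊛ mono new) ⊛ (qbinom M j ⊛ qp2-from (suc s ℕ.+ j) (M ∸ j))
        ≈⟨ solve 4 (λ c d g t → (c :* d) :* (g :* t) := c :* ((g :* d) :* t)) ≋.refl
             (mono (chuExp M s)) (mono new) (qbinom M j) (qp2-from (suc s ℕ.+ j) (M ∸ j)) ⟩
      mono (chuExp M s) ⊛ chuTerm M (suc s) j
        ∎
      where
      open ≋-Reasoning
      open SeriesSolver using (solve; _:*_; _:=_)
      old = 2 ℕ.* (suc j ℕ.* suc j ℕ.+ s ℕ.* suc j)
      new = 2 ℕ.* (j ℕ.* j ℕ.+ suc s ℕ.* j)
      exp≡′ : ∀ j d s → 2 ℕ.* d ℕ.+ 2 ℕ.* (suc j ℕ.* suc j ℕ.+ s ℕ.* suc j)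
                        ≡ 2 ℕ.* ((j ℕ.+ d) ℕ.+ s ℕ.+ 1) ℕ.+ 2 ℕ.* (j ℕ.* j ℕ.+ suc s ℕ.* j)
      exp≡′ = solve-∀
      exp≡ : 2 ℕ.* (M ∸ j) ℕ.+ old ≡ chuExp M s ℕ.+ new
      exp≡ = P.subst (λ M → 2 ℕ.* (M ∸ j) ℕ.+ old ≡ chuExp M s ℕ.+ new) (NP.m+[n∸m]≡n j≤M)
               (P.trans (P.cong (λ k → 2 ℕ.* k ℕ.+ old) (NP.m+n∸m≡n j (M ∸ j))) (exp≡′ j (M ∸ j) s))

  chuSum≋1 : ∀ M s → chuSum M s ≋ oneS
  chuSum≋1 zero    s = ≋.trans (≋.+-identityˡ (chuTerm 0 s 0))
    (≋.trans (≋.*-identityʳ _) (≋.trans (≋.*-identityˡ _) (mono-≡ (P.cong (2 ℕ.*_) (NP.*-zeroʳ s)))))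
  chuSum≋1 (suc M) s = begin
    chuSum (suc M) s
      ≈⟨ ΣS-front (suc M) (chuTerm (suc M) s) ⟩
    chuTerm (suc M) s 0 ⊕ ΣS< (suc M) (λ j → chuTerm (suc M) s (suc j))
      ≈⟨ ≋.+-congˡ (≋.trans (ΣS-cong (suc M) (λ j _ → chuTerm-pascal M s j)) (ΣS-+ (suc M) _ _)) ⟩
    chuTerm (suc M) s 0 ⊕ (ΣS< (suc M) (chuOld M s) ⊕ ΣS< (suc M) (chuNew M s))
      ≈⟨ ≋.sym (≋.+-assoc _ _ _) ⟩
    (chuTerm (suc M) s 0 ⊕ ΣS< (suc M) (chuOld M s)) ⊕ ΣS< (suc M) (chuNew M s)
      ≈⟨ ≋.+-cong old-part new-part ⟩
    (1-q^ E ⊛ chuSum M s) ⊕ (mono E ⊛ chuSum M (suc s))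
      ≈⟨ ≋.+-cong (≋.*-congˡ {1-q^ E} (chuSum≋1 M s)) (≋.*-congˡ {mono E} (chuSum≋1 M (suc s))) ⟩
    (1-q^ E ⊛ oneS) ⊕ (mono E ⊛ oneS)
      ≈⟨ solve 1 (λ m → (1ₑ :- m) :* 1ₑ :+ m :* 1ₑ := 1ₑ) ≋.refl (mono E) ⟩
    oneS
      ∎
    where
    open ≋-Reasoning
    open SeriesSolver using (solve; _:+_; _:*_; _:-_; _:=_)
    E = chuExp M s
    old-part : (chuTerm (suc M) s 0 ⊕ ΣS< (suc M) (chuOld M s)) ≋ (1-q^ E ⊛ chuSum M s)
    old-part = begin
      chuTerm (suc M) s 0 ⊕ (ΣS< M (chuOld M s) ⊕ chuOld M s M)
        ≈⟨ ≋.+-cong (chuTerm-head M s) (≋.trans (≋.+-congˡ (chuOld-last M s)) (≋.+-identityʳ _)) ⟩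
      (1-q^ E ⊛ chuTerm M s 0) ⊕ ΣS< M (chuOld M s)
        ≈⟨ ≋.+-congˡ (≋.trans (ΣS-cong M (chuOld≋ M s)) (≋.sym (⊛-ΣS M (1-q^ E) (λ j → chuTerm M s (suc j))))) ⟩
      (1-q^ E ⊛ chuTerm M s 0) ⊕ (1-q^ E ⊛ ΣS< M (λ j → chuTerm M s (suc j)))
        ≈⟨ ≋.sym (≋.distribˡ (1-q^ E) (chuTerm M s 0) (ΣS< M (λ j → chuTerm M s (suc j)))) ⟩
      1-q^ E ⊛ (chuTerm M s 0 ⊕ ΣS< M (λ j → chuTerm M s (suc j)))
        ≈⟨ ≋.*-congˡ {1-q^ E} (≋.sym (ΣS-front M (chuTerm M s))) ⟩
      1-q^ E ⊛ chuSum M s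
        ∎
    new-part : ΣS< (suc M) (chuNew M s) ≋ (mono E ⊛ chuSum M (suc s))
    new-part = ≋.trans (ΣS-cong (suc M) (λ j j≤M → chuNew≋ M s j (NP.≤-pred j≤M)))
                       (≋.sym (⊛-ΣS (suc M) (mono E) (chuTerm M (suc s))))

  qbinom-qp2 : ∀ M i → i ≤ M → ((qbinom M i ⊛ qp2 i) ⊛ qp2 (M ∸ i)) ≋ qp2 M
  qbinom-qp2 zero    zero    _         = ≋.trans (≋.*-identityʳ (oneS ⊛ oneS)) (≋.*-identityʳ oneS)
  qbinom-qp2 (suc M) zero    _         = ≋.trans (≋.*-congʳ {qp2 (suc M)} (≋.*-identityʳ oneS)) (≋.*-identityˡ (qp2 (suc M)))
  qbinom-qp2 (suc M) (suc j) (s≤s j≤M) = begin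
    ((qbinom M (suc j) ⊕ (u ⊛ qbinom M j)) ⊛ qp2 (suc j)) ⊛ qp2 (M ∸ j)
      ≈⟨ solve 5 (λ a u b p q → ((a :+ u :* b) :* p) :* q := (a :* p) :* q :+ u :* ((b :* p) :* q)) ≋.refl
           (qbinom M (suc j)) u (qbinom M j) (qp2 (suc j)) (qp2 (M ∸ j)) ⟩
    ((qbinom M (suc j) ⊛ qp2 (suc j)) ⊛ qp2 (M ∸ j)) ⊕ (u ⊛ ((qbinom M j ⊛ qp2 (suc j)) ⊛ qp2 (M ∸ j)))
      ≈⟨ ≋.+-cong upper (≋.*-congˡ {u} lower) ⟩
    (qp2 M ⊛ (oneS ⊖ u)) ⊕ (u ⊛ ((oneS ⊖ v) ⊛ qp2 M))
      ≈⟨ solve 3 (λ q u v → q :* (1ₑ :- u) :+ u :* ((1ₑ :- v) :* q) := q :* (1ₑ :- u :* v)) ≋.refl (qp2 M) u v ⟩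
    qp2 M ⊛ (oneS ⊖ (u ⊛ v))
      ≈⟨ ≋.*-congˡ {qp2 M} (≋.+-congˡ {oneS} (≋.-‿cong (≋.trans (mono-+ (2 ℕ.* (M ∸ j)) (2 ℕ.* suc j)) (mono-≡ exp≡)))) ⟩
    qp2 (suc M)
      ∎
    where
    open ≋-Reasoning
    open SeriesSolver using (solve; _:+_; _:*_; _:-_; _:=_)
    u = mono (2 ℕ.* (M ∸ j))
    v = mono (2 ℕ.* suc j)
    exp≡′ : ∀ j d → 2 ℕ.* d ℕ.+ 2 ℕ.* suc j ≡ 2 ℕ.* suc (j ℕ.+ d)
    exp≡′ = solve-∀
    exp≡ : 2 ℕ.* (M ∸ j) ℕ.+ 2 ℕ.* suc j ≡ 2 ℕ.* suc M
    exp≡ = P.subst (λ M → 2 ℕ.* (M ∸ j) ℕ.+ 2 ℕ.* suc j ≡ 2 ℕ.* suc M) (NP.m+[n∸m]≡n j≤M)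
             (P.trans (P.cong (λ k → 2 ℕ.* k ℕ.+ 2 ℕ.* suc j) (NP.m+n∸m≡n j (M ∸ j))) (exp≡′ j (M ∸ j)))
    lower : ((qbinom M j ⊛ qp2 (suc j)) ⊛ qp2 (M ∸ j)) ≋ ((oneS ⊖ v) ⊛ qp2 M)
    lower = ≋.trans (solve 4 (λ g p o q → (g :* (p :* o)) :* q := o :* ((g :* p) :* q)) ≋.refl
                      (qbinom M j) (qp2 j) (oneS ⊖ v) (qp2 (M ∸ j)))
                    (≋.*-congˡ {oneS ⊖ v} (qbinom-qp2 M j j≤M))
    upper : ((qbinom M (suc j) ⊛ qp2 (suc j)) ⊛ qp2 (M ∸ j)) ≋ (qp2 M ⊛ (oneS ⊖ u))
    upper with j ℕ.<? M
    ... | yes j<M = ≋.trans (≋.*-congˡ {qbinom M (suc j) ⊛ qp2 (suc j)}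
                      (≋.trans (qp2-≡ (P.sym 1+[M∸1+j]≡M∸j)) (≋.*-congˡ {qp2 (M ∸ suc j)} (1-q^-≡ (P.cong (2 ℕ.*_) 1+[M∸1+j]≡M∸j)))))
                    (≋.trans (≋.sym (≋.*-assoc (qbinom M (suc j) ⊛ qp2 (suc j)) (qp2 (M ∸ suc j)) (oneS ⊖ u)))
                             (≋.*-congʳ {oneS ⊖ u} (qbinom-qp2 M (suc j) j<M)))
      where
      1+[M∸1+j]≡M∸j : suc (M ∸ suc j) ≡ M ∸ j
      1+[M∸1+j]≡M∸j = P.sym (NP.+-∸-assoc 1 j<M)
    ... | no j≮M = ≋.trans (≋.trans (≋.*-congʳ {qp2 (M ∸ j)} (≋.trans (≋.*-congʳ {qp2 (suc j)} (qbinom-above M (suc j) (s≤s M≤j)))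
                             (≋.zeroˡ (qp2 (suc j))))) (≋.zeroˡ (qp2 (M ∸ j))))
                           (≋.sym (⊛-zeroS (qp2 M) 1-u≋0))
      where
      M≤j : M ≤ j
      M≤j = NP.≮⇒≥ j≮M
      1-u≋0 : (oneS ⊖ u) ≋ zeroS
      1-u≋0 = ≋.trans (1-q^-≡ (P.cong (2 ℕ.*_) (NP.m≤n⇒m∸n≡0 M≤j))) (λ n → -‿inverseʳ (oneS n))

  qp2-split : ∀ a l → qp2 (a ℕ.+ l) ≋ (qp2 a ⊛ qp2-from a l)
  qp2-split a zero    = ≋.trans (qp2-≡ (NP.+-identityʳ a)) (≋.sym (≋.*-identityʳ (qp2 a)))
  qp2-split a (suc l) = ≋.trans (qp2-≡ (NP.+-suc a l))
    (≋.trans (≋.*-cong (qp2-split a l) (1-q^-≡ (P.cong (2 ℕ.*_) (P.sym (NP.+-suc a l)))))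
             (≋.*-assoc (qp2 a) (qp2-from a l) (1-q^ (2 ℕ.* (a ℕ.+ suc l)))))

  qbinom≋ : ∀ M i → i ≤ M → qbinom M i ≋ ((qp2 M ⊛ qp2⁻¹ (M ∸ i)) ⊛ qp2⁻¹ i)
  qbinom≋ M i i≤M = ⊛-transpose {u = qp2 i} (qp2⁻¹-inverse i)
                      (⊛-transpose {u = qp2 (M ∸ i)} (qp2⁻¹-inverse (M ∸ i)) (qbinom-qp2 M i i≤M))

  qp2-from≋ : ∀ M s i → i ≤ M → qp2-from (s ℕ.+ i) (M ∸ i) ≋ (qp2 (M ℕ.+ s) ⊛ qp2⁻¹ (s ℕ.+ i))
  qp2-from≋ M s i i≤M = ⊛-transpose {u = qp2 (s ℕ.+ i)} (qp2⁻¹-inverse (s ℕ.+ i))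
    (≋.trans (≋.*-comm (qp2-from (s ℕ.+ i) (M ∸ i)) (qp2 (s ℕ.+ i)))
             (≋.trans (≋.sym (qp2-split (s ℕ.+ i) (M ∸ i))) (qp2-≡ length≡)))
    where
    length≡ : (s ℕ.+ i) ℕ.+ (M ∸ i) ≡ M ℕ.+ s
    length≡ = P.trans (NP.+-assoc s i (M ∸ i)) (P.trans (P.cong (s ℕ.+_) (NP.m+[n∸m]≡n i≤M)) (NP.+-comm s M))

  chuRatio : ℕ → ℕ → ℕ → PS
  chuRatio M s i = ((qp2⁻¹ i ⊛ qp2⁻¹ (M ∸ i)) ⊛ mono (2 ℕ.* (i ℕ.* i ℕ.+ s ℕ.* i))) ⊛ qp2⁻¹ (s ℕ.+ i)

  chuTerm≋ : ∀ M s i → i ≤ M → chuTerm M s i ≋ ((qp2 M ⊛ qp2 (M ℕ.+ s)) ⊛ chuRatio M s i)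
  chuTerm≋ M s i i≤M =
    ≋.trans (≋.*-cong (≋.*-congʳ {mono (2 ℕ.* (i ℕ.* i ℕ.+ s ℕ.* i))} (qbinom≋ M i i≤M)) (qp2-from≋ M s i i≤M))
      (solve 6 (λ qM ιM-i ιi m qMs ιs+i → (((qM :* ιM-i) :* ιi) :* m) :* (qMs :* ιs+i)
                                           := (qM :* qMs) :* (((ιi :* ιM-i) :* m) :* ιs+i)) ≋.refl
         (qp2 M) (qp2⁻¹ (M ∸ i)) (qp2⁻¹ i) (mono (2 ℕ.* (i ℕ.* i ℕ.+ s ℕ.* i))) (qp2 (M ℕ.+ s)) (qp2⁻¹ (s ℕ.+ i)))
    where open SeriesSolver using (solve; _:*_; _:=_)

  Σ-chuRatio : ∀ M s → ΣS< (suc M) (chuRatio M s) ≋ (qp2⁻¹ M ⊛ qp2⁻¹ (M ℕ.+ s))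
  Σ-chuRatio M s = ≋.trans (⊛-transpose {u = K} K⁻¹K≋1 ΣK≋1) (≋.*-identityˡ (qp2⁻¹ M ⊛ qp2⁻¹ (M ℕ.+ s)))
    where
    open SeriesSolver using (solve; _:*_; _:=_)
    K = qp2 M ⊛ qp2 (M ℕ.+ s)
    K⁻¹K≋1 : ((qp2⁻¹ M ⊛ qp2⁻¹ (M ℕ.+ s)) ⊛ K) ≋ oneS
    K⁻¹K≋1 = ≋.trans (solve 4 (λ a b c d → (a :* b) :* (c :* d) := (a :* c) :* (b :* d)) ≋.refl
                        (qp2⁻¹ M) (qp2⁻¹ (M ℕ.+ s)) (qp2 M) (qp2 (M ℕ.+ s)))
                     (≋.trans (≋.*-cong (qp2⁻¹-inverse M) (qp2⁻¹-inverse (M ℕ.+ s))) (≋.*-identityʳ oneS))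
    ΣK≋1 : (ΣS< (suc M) (chuRatio M s) ⊛ K) ≋ oneS
    ΣK≋1 = ≋.trans (≋.*-comm (ΣS< (suc M) (chuRatio M s)) K) (≋.trans (⊛-ΣS (suc M) K (chuRatio M s))
             (≋.trans (ΣS-cong (suc M) (λ i i≤M → ≋.sym (chuTerm≋ M s i (NP.≤-pred i≤M)))) (chuSum≋1 M s)))

  baileyTerm : ℕ → ℕ → ℕ → PS
  baileyTerm m r t = ((mono (2 ℕ.* ((r ℕ.+ t) ℕ.* (r ℕ.+ t))) ⊛ qp2⁻¹ (m ∸ (r ℕ.+ t))) ⊛ qp2⁻¹ t)
                       ⊛ qp2⁻¹ (2 ℕ.* r ℕ.+ t)

  bailey-lemma : ∀ m r → r ≤ m →
    ΣS< (suc (m ∸ r)) (baileyTerm m r) ≋ ((mono (2 ℕ.* (r ℕ.* r)) ⊛ qp2⁻¹ (m ∸ r)) ⊛ qp2⁻¹ (m ℕ.+ r))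
  bailey-lemma m r r≤m = begin
    ΣS< (suc M) (baileyTerm m r)                    ≈⟨ ΣS-cong (suc M) (λ t _ → ≋.sym (summand t)) ⟩
    ΣS< (suc M) (λ t → q^2r² ⊛ chuRatio M s t)      ≈⟨ ≋.sym (⊛-ΣS (suc M) q^2r² (chuRatio M s)) ⟩
    q^2r² ⊛ ΣS< (suc M) (chuRatio M s)              ≈⟨ ≋.*-congˡ {q^2r²} (Σ-chuRatio M s) ⟩
    q^2r² ⊛ (qp2⁻¹ M ⊛ qp2⁻¹ (M ℕ.+ s))             ≈⟨ ≋.trans (≋.sym (≋.*-assoc q^2r² (qp2⁻¹ M) (qp2⁻¹ (M ℕ.+ s))))
                                                          (≋.*-congˡ {q^2r² ⊛ qp2⁻¹ M} (qp2⁻¹-≡ M+s≡m+r)) ⟩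
    (q^2r² ⊛ qp2⁻¹ (m ∸ r)) ⊛ qp2⁻¹ (m ℕ.+ r)       ∎
    where
    open ≋-Reasoning
    open SeriesSolver using (solve; _:*_; _:=_)
    M = m ∸ r
    s = 2 ℕ.* r
    q^2r² = mono (2 ℕ.* (r ℕ.* r))
    arith₁ : ∀ r d → d ℕ.+ 2 ℕ.* r ≡ (r ℕ.+ d) ℕ.+ r
    arith₁ = solve-∀
    arith₂ : ∀ r i → 2 ℕ.* (r ℕ.* r) ℕ.+ 2 ℕ.* (i ℕ.* i ℕ.+ (2 ℕ.* r) ℕ.* i) ≡ 2 ℕ.* ((r ℕ.+ i) ℕ.* (r ℕ.+ i))
    arith₂ = solve-∀
    M+s≡m+r : M ℕ.+ s ≡ m ℕ.+ r
    M+s≡m+r = P.subst (λ m → (m ∸ r) ℕ.+ 2 ℕ.* r ≡ m ℕ.+ r) (NP.m+[n∸m]≡n r≤m)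
                (P.trans (P.cong (ℕ._+ 2 ℕ.* r) (NP.m+n∸m≡n r (m ∸ r))) (arith₁ r (m ∸ r)))
    summand : ∀ t → (q^2r² ⊛ chuRatio M s t) ≋ baileyTerm m r t
    summand t = ≋.trans
      (solve 5 (λ a b c d e → a :* (((b :* c) :* d) :* e) := (((a :* d) :* c) :* b) :* e) ≋.refl
         q^2r² (qp2⁻¹ t) (qp2⁻¹ (M ∸ t)) (mono (2 ℕ.* (t ℕ.* t ℕ.+ s ℕ.* t))) (qp2⁻¹ (s ℕ.+ t)))
      (≋.*-congʳ {qp2⁻¹ (s ℕ.+ t)} (≋.*-congʳ {qp2⁻¹ t}
        (≋.*-cong (≋.trans (mono-+ (2 ℕ.* (r ℕ.* r)) (2 ℕ.* (t ℕ.* t ℕ.+ s ℕ.* t))) (mono-≡ (arith₂ r t)))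
                  (qp2⁻¹-≡ (NP.∸-+-assoc m r t)))))

  q²^ : ℕ → PS
  q²^ e = mono (2 ℕ.* e)

  1+q²^ : ℕ → PS
  1+q²^ e = oneS ⊕ q²^ e

  1-q²^ : ℕ → PS
  1-q²^ e = 1-q^ (2 ℕ.* e)

  q²^-+ : ∀ x y → q²^ (x ℕ.+ y) ≋ (q²^ x ⊛ q²^ y)
  q²^-+ x y = ≋.trans (mono-≡ (NP.*-distribˡ-+ 2 x y)) (≋.sym (mono-+ (2 ℕ.* x) (2 ℕ.* y)))

  q²^-split₃ : ∀ {x} u v w → x ≡ u ℕ.+ v ℕ.+ w → q²^ x ≋ ((q²^ u ⊛ q²^ v) ⊛ q²^ w)
  q²^-split₃ u v w P.refl = ≋.trans (q²^-+ (u ℕ.+ v) w) (≋.*-congʳ {q²^ w} (q²^-+ u v))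

  q²^-split₄ : ∀ {x} u v w t → x ≡ u ℕ.+ v ℕ.+ w ℕ.+ t → q²^ x ≋ (((q²^ u ⊛ q²^ v) ⊛ q²^ w) ⊛ q²^ t)
  q²^-split₄ u v w t P.refl = ≋.trans (q²^-+ (u ℕ.+ v ℕ.+ w) t) (≋.*-congʳ {q²^ t} (q²^-split₃ u v w P.refl))

  1⊖-cong : ∀ {m m′} → m ≋ m′ → (oneS ⊖ m) ≋ (oneS ⊖ m′)
  1⊖-cong m≋m′ n = +-congˡ (-‿cong (m≋m′ n))

  -- cbinom n r = [2n, n-r]_{q²}, defined by the recurrence that the product
  -- Π_j (1 + 2x q^{2j-1} + q^{4j-2}) forces on its coefficients; cbinom n r-1
  -- and cbinom n r+1 enter because 2x q^{r²}(V_r + V_{r-1}) splits into the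
  -- neighbouring terms q^{(r±1)²}(V_{r±1} + V_{r±1-1}).
  cbinom : ℕ → ℕ → PS
  cbinom zero    zero    = oneS
  cbinom zero    (suc r) = zeroS
  cbinom (suc n) zero    = (1+q²^ (suc (2 ℕ.* n)) ⊛ cbinom n 0) ⊕ ((q²^ (suc n) ⊕ q²^ (suc n)) ⊛ cbinom n 1)
  cbinom (suc n) (suc r) = ((1+q²^ (suc (2 ℕ.* n)) ⊛ cbinom n (suc r)) ⊕ (q²^ (n ∸ r) ⊛ cbinom n r))
                             ⊕ (q²^ (suc (suc (n ℕ.+ r))) ⊛ cbinom n (suc (suc r)))

  cbinom-above : ∀ n r → n < r → cbinom n r ≋ zeroS
  cbinom-above zero    (suc r) _         = ≋.refl
  cbinom-above (suc n) (suc r) (s≤s n<r) = ≋.trans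
    (≋.+-cong (≋.+-cong (⊛-zeroS (1+q²^ (suc (2 ℕ.* n))) (cbinom-above n (suc r) (NP.m<n⇒m<1+n n<r)))
                        (⊛-zeroS (q²^ (n ∸ r)) (cbinom-above n r n<r)))
              (⊛-zeroS (q²^ (suc (suc (n ℕ.+ r)))) (cbinom-above n (suc (suc r)) (NP.m<n⇒m<1+n (NP.m<n⇒m<1+n n<r)))))
    (λ _ → trans (+-identityʳ _) (+-identityʳ _))

  cbinomQ : ℕ → ℕ → PS
  cbinomQ n r = (cbinom n r ⊛ qp2 (n ∸ r)) ⊛ qp2 (n ℕ.+ r)

  ClosedForm : ℕ → Set ℓ
  ClosedForm n = ∀ r → r ≤ n → cbinomQ n r ≋ qp2 (2 ℕ.* n)

  closed-form-at : ∀ {n} → ClosedForm n → ∀ r {a b} → r ≤ n → n ∸ r ≡ a → n ℕ.+ r ≡ b →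
                   ((cbinom n r ⊛ qp2 a) ⊛ qp2 b) ≋ qp2 (2 ℕ.* n)
  closed-form-at IH r r≤n P.refl P.refl = IH r r≤n

  cbinomQ≋ : ∀ {n r a b} → n ∸ r ≡ a → n ℕ.+ r ≡ b → cbinomQ n r ≋ (cbinom n r ⊛ (qp2 a ⊛ qp2 b))
  cbinomQ≋ {n} {r} P.refl P.refl = ≋.*-assoc (cbinom n r) (qp2 (n ∸ r)) (qp2 (n ℕ.+ r))

  qp2-2+2n : ∀ n → (qp2 (2 ℕ.* n) ⊛ (1-q²^ (suc (2 ℕ.* n)) ⊛ 1-q²^ (suc (suc (2 ℕ.* n))))) ≋ qp2 (2 ℕ.* suc n)
  qp2-2+2n n = ≋.trans (≋.sym (≋.*-assoc (qp2 (2 ℕ.* n)) (1-q²^ (suc (2 ℕ.* n))) (1-q²^ (suc (suc (2 ℕ.* n))))))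
                       (qp2-≡ (P.sym (two-suc n)))
    where
    two-suc : ∀ n → 2 ℕ.* suc n ≡ suc (suc (2 ℕ.* n))
    two-suc = solve-∀

  -- One step of the recurrence: each cbinom n r times its own pair of
  -- Pochhammer factors is X, and the common denominator B is that pair times k.
  -- Callers must supply the implicit arguments: _≋_ unfolds pointwise, so
  -- Agda cannot infer them from the hypotheses.
  module _ {X B : PS} where
    open SeriesSolver using (solve; _:*_; _:=_)

    transfer₁ : ∀ g {D P₁ P₂ k} → ((D ⊛ P₁) ⊛ P₂) ≋ X → B ≋ ((P₁ ⊛ P₂) ⊛ k) → ((g ⊛ D) ⊛ B) ≋ (X ⊛ (g ⊛ k))
    transfer₁ g {D} {P₁} {P₂} {k} DP≋X B≋Pk = begin
      (g ⊛ D) ⊛ B                  ≈⟨ ≋.*-congˡ {g ⊛ D} B≋Pk ⟩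
      (g ⊛ D) ⊛ ((P₁ ⊛ P₂) ⊛ k)    ≈⟨ solve 5 (λ g D P₁ P₂ k → (g :* D) :* ((P₁ :* P₂) :* k) := ((D :* P₁) :* P₂) :* (g :* k))
                                        ≋.refl g D P₁ P₂ k ⟩
      ((D ⊛ P₁) ⊛ P₂) ⊛ (g ⊛ k)    ≈⟨ ≋.*-congʳ {g ⊛ k} DP≋X ⟩
      X ⊛ (g ⊛ k)                  ∎
      where open ≋-Reasoning

    transfer₂ : ∀ g₁ g₂ {D₁ P₁ P₁′ k₁ D₂ P₂ P₂′ k₂} →
      ((D₁ ⊛ P₁) ⊛ P₁′) ≋ X → B ≋ ((P₁ ⊛ P₁′) ⊛ k₁) →
      ((D₂ ⊛ P₂) ⊛ P₂′) ≋ X → B ≋ ((P₂ ⊛ P₂′) ⊛ k₂) →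
      (((g₁ ⊛ D₁) ⊕ (g₂ ⊛ D₂)) ⊛ B) ≋ (X ⊛ ((g₁ ⊛ k₁) ⊕ (g₂ ⊛ k₂)))
    transfer₂ g₁ g₂ {D₁} {P₁} {P₁′} {k₁} {D₂} {P₂} {P₂′} {k₂} e₁ f₁ e₂ f₂ =
      ≋.trans (≋.distribʳ B (g₁ ⊛ D₁) (g₂ ⊛ D₂))
        (≋.trans (≋.+-cong (transfer₁ g₁ {D₁} {P₁} {P₁′} {k₁} e₁ f₁) (transfer₁ g₂ {D₂} {P₂} {P₂′} {k₂} e₂ f₂))
                 (≋.sym (≋.distribˡ X (g₁ ⊛ k₁) (g₂ ⊛ k₂))))

    transfer₃ : ∀ g₁ g₂ g₃ {D₁ P₁ P₁′ k₁ D₂ P₂ P₂′ k₂ D₃ P₃ P₃′ k₃} →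
      ((D₁ ⊛ P₁) ⊛ P₁′) ≋ X → B ≋ ((P₁ ⊛ P₁′) ⊛ k₁) →
      ((D₂ ⊛ P₂) ⊛ P₂′) ≋ X → B ≋ ((P₂ ⊛ P₂′) ⊛ k₂) →
      ((D₃ ⊛ P₃) ⊛ P₃′) ≋ X → B ≋ ((P₃ ⊛ P₃′) ⊛ k₃) →
      ((((g₁ ⊛ D₁) ⊕ (g₂ ⊛ D₂)) ⊕ (g₃ ⊛ D₃)) ⊛ B) ≋ (X ⊛ (((g₁ ⊛ k₁) ⊕ (g₂ ⊛ k₂)) ⊕ (g₃ ⊛ k₃)))
    transfer₃ g₁ g₂ g₃ {D₁} {P₁} {P₁′} {k₁} {D₂} {P₂} {P₂′} {k₂} {D₃} {P₃} {P₃′} {k₃} e₁ f₁ e₂ f₂ e₃ f₃ =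
      ≋.trans (≋.distribʳ B ((g₁ ⊛ D₁) ⊕ (g₂ ⊛ D₂)) (g₃ ⊛ D₃))
        (≋.trans (≋.+-cong (transfer₂ g₁ g₂ {D₁} {P₁} {P₁′} {k₁} {D₂} {P₂} {P₂′} {k₂} e₁ f₁ e₂ f₂)
                           (transfer₁ g₃ {D₃} {P₃} {P₃′} {k₃} e₃ f₃))
                 (≋.sym (≋.distribˡ X ((g₁ ⊛ k₁) ⊕ (g₂ ⊛ k₂)) (g₃ ⊛ k₃))))

  private
    -- In the solver calls below a = q², p = q^{2(d+1)}, y = w = q^{2(K+1)} and b = q^{2n}.
    interior-coefficients : ∀ d K s → s ≡ suc (suc (d ℕ.+ K)) →
      (((1+q²^ (suc s) ⊛ (1-q²^ (suc (suc d)) ⊛ 1-q²^ (suc (suc K))))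
        ⊕ (q²^ (suc (suc d)) ⊛ (1-q²^ (suc K) ⊛ 1-q²^ (suc (suc K)))))
        ⊕ (q²^ (suc (suc K)) ⊛ (1-q²^ (suc d) ⊛ 1-q²^ (suc (suc d)))))
      ≋ (1-q²^ (suc s) ⊛ 1-q²^ (suc (suc s)))
    interior-coefficients d K s s≡ = ≋.trans
      (≋.+-cong (≋.+-cong (≋.*-cong (≋.+-congˡ {oneS} S₁) (≋.*-cong (1⊖-cong A) (1⊖-cong Y)))
                          (≋.*-cong A (≋.*-congˡ {1-q²^ (suc K)} (1⊖-cong Y))))
                (≋.*-cong Y (≋.*-congˡ {1-q²^ (suc d)} (1⊖-cong A))))
      (≋.trans (solve 3 (λ a p y → ((1ₑ :+ (a :* p) :* y) :* ((1ₑ :- a :* p) :* (1ₑ :- a :* y))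
                                      :+ (a :* p) :* ((1ₑ :- y) :* (1ₑ :- a :* y)))
                                      :+ (a :* y) :* ((1ₑ :- p) :* (1ₑ :- a :* p))
                                    := (1ₑ :- (a :* p) :* y) :* (1ₑ :- ((a :* a) :* p) :* y))
                 ≋.refl (q²^ 1) (q²^ (suc d)) (q²^ (suc K)))
               (≋.sym (≋.*-cong (1⊖-cong S₁) (1⊖-cong S₂))))
      where
      open SeriesSolver using (solve; _:+_; _:*_; _:-_; _:=_)
      A = q²^-+ 1 (suc d)
      Y = q²^-+ 1 (suc K)
      S₁ = q²^-split₃ 1 (suc d) (suc K) (P.cong suc (P.trans s≡ (P.cong suc (P.sym (NP.+-suc d K)))))
      S₂ = q²^-split₄ 1 1 (suc d) (suc K) (P.cong (λ k → suc (suc k)) (P.trans s≡ (P.cong suc (P.sym (NP.+-suc d K)))))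

    subdiagonal-coefficients : ∀ K s → s ≡ suc K →
      ((1+q²^ (suc s) ⊛ (1-q²^ 1 ⊛ 1-q²^ (suc (suc K)))) ⊕ (q²^ 1 ⊛ (1-q²^ (suc K) ⊛ 1-q²^ (suc (suc K)))))
      ≋ (1-q²^ (suc s) ⊛ 1-q²^ (suc (suc s)))
    subdiagonal-coefficients K s P.refl = ≋.trans
      (≋.+-cong (≋.*-cong (≋.+-congˡ {oneS} AW) (≋.*-congˡ {1-q²^ 1} (1⊖-cong AW)))
                (≋.*-congˡ {q²^ 1} (≋.*-congˡ {1-q²^ (suc K)} (1⊖-cong AW))))
      (≋.trans (solve 2 (λ a w → (1ₑ :+ a :* w) :* ((1ₑ :- a) :* (1ₑ :- a :* w)) :+ a :* ((1ₑ :- w) :* (1ₑ :- a :* w))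
                                := (1ₑ :- a :* w) :* (1ₑ :- (a :* a) :* w))
                 ≋.refl (q²^ 1) (q²^ (suc K)))
               (≋.sym (≋.*-cong (1⊖-cong AW) (1⊖-cong (q²^-split₃ 1 1 (suc K) P.refl)))))
      where
      open SeriesSolver using (solve; _:+_; _:*_; _:-_; _:=_)
      AW = q²^-+ 1 (suc K)

    edge-coefficients : ∀ n →
      ((1+q²^ (suc (2 ℕ.* n)) ⊛ (1-q²^ (suc n) ⊛ 1-q²^ (suc n))) ⊕ ((q²^ (suc n) ⊕ q²^ (suc n)) ⊛ (1-q²^ n ⊛ 1-q²^ (suc n))))
      ≋ (1-q²^ (suc (2 ℕ.* n)) ⊛ 1-q²^ (suc (suc (2 ℕ.* n))))
    edge-coefficients n = ≋.trans
      (≋.+-cong (≋.*-cong (≋.+-congˡ {oneS} S₁) (≋.*-cong (1⊖-cong B) (1⊖-cong B)))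
                (≋.*-cong (≋.+-cong B B) (≋.*-congˡ {1-q²^ n} (1⊖-cong B))))
      (≋.trans (solve 2 (λ a b → (1ₑ :+ (a :* b) :* b) :* ((1ₑ :- a :* b) :* (1ₑ :- a :* b))
                                   :+ (a :* b :+ a :* b) :* ((1ₑ :- b) :* (1ₑ :- a :* b))
                                := (1ₑ :- (a :* b) :* b) :* (1ₑ :- ((a :* a) :* b) :* b))
                 ≋.refl (q²^ 1) (q²^ n))
               (≋.sym (≋.*-cong (1⊖-cong S₁) (1⊖-cong (q²^-split₄ 1 1 n n (exp≡₂ n))))))
      where
      open SeriesSolver using (solve; _:+_; _:*_; _:-_; _:=_)
      exp≡₁ : ∀ n → suc (2 ℕ.* n) ≡ 1 ℕ.+ n ℕ.+ n
      exp≡₁ = solve-∀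
      exp≡₂ : ∀ n → suc (suc (2 ℕ.* n)) ≡ 1 ℕ.+ 1 ℕ.+ n ℕ.+ n
      exp≡₂ = solve-∀
      B = q²^-+ 1 n
      S₁ = q²^-split₃ 1 n n (exp≡₁ n)

  private
    ∸-≡ : ∀ {x} r k → x ≡ r ℕ.+ k → x ∸ r ≡ k
    ∸-≡ r k P.refl = NP.m+n∸m≡n r k

    q²^-≡ : ∀ {a b} → a ≡ b → q²^ a ≋ q²^ b
    q²^-≡ P.refl = ≋.refl

  closed-form-interior : ∀ r d → ClosedForm (suc (suc (r ℕ.+ d))) →
    cbinomQ (suc (suc (suc (r ℕ.+ d)))) (suc r) ≋ qp2 (2 ℕ.* suc (suc (suc (r ℕ.+ d))))
  closed-form-interior r d IH = begin
    cbinomQ (suc n) (suc r)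
      ≈⟨ cbinomQ≋ {suc n} {suc r} n∸r≡2+d (P.cong suc (NP.+-suc n r)) ⟩
    cbinom (suc n) (suc r) ⊛ B
      ≈⟨ ≋.*-congʳ {B} (≋.+-congʳ {q²^ (suc (suc K)) ⊛ cbinom n (suc (suc r))}
                        (≋.+-congˡ {g ⊛ cbinom n (suc r)} (≋.*-congʳ {cbinom n r} (q²^-≡ n∸r≡2+d)))) ⟩
    (((g ⊛ cbinom n (suc r)) ⊕ (q²^ (suc (suc d)) ⊛ cbinom n r)) ⊕ (q²^ (suc (suc K)) ⊛ cbinom n (suc (suc r)))) ⊛ B
      ≈⟨ transfer₃ g (q²^ (suc (suc d))) (q²^ (suc (suc K))) {cbinom n (suc r)} {qp2 (suc d)} {qp2 (suc K)} {o₂ ⊛ oK₂}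
                   {cbinom n r} {qp2 (suc (suc d))} {qK} {oK₁ ⊛ oK₂}
                   {cbinom n (suc (suc r))} {qd} {qp2 (suc (suc K))} {o₁ ⊛ o₂}
                   (closed-form-at IH (suc r) (NP.≤-trans (NP.n≤1+n (suc r)) (s≤s (s≤s (NP.m≤m+n r d))))
                                     (∸-≡ (suc r) (suc d) (arith₁ r d)) (NP.+-suc n r))
                   factor₁
                   (closed-form-at IH r (NP.≤-trans (NP.m≤m+n r d) (NP.≤-trans (NP.n≤1+n _) (NP.n≤1+n _)))
                                     n∸r≡2+d P.refl)
                   factor₂
                   (closed-form-at IH (suc (suc r)) (s≤s (s≤s (NP.m≤m+n r d)))
                                     (∸-≡ (suc (suc r)) d P.refl) (P.trans (NP.+-suc n (suc r)) (P.cong suc (NP.+-suc n r))))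
                   factor₃ ⟩
    qp2 (2 ℕ.* n) ⊛ (((g ⊛ (o₂ ⊛ oK₂)) ⊕ (q²^ (suc (suc d)) ⊛ (oK₁ ⊛ oK₂))) ⊕ (q²^ (suc (suc K)) ⊛ (o₁ ⊛ o₂)))
      ≈⟨ ≋.*-congˡ {qp2 (2 ℕ.* n)} (interior-coefficients d K (2 ℕ.* n) (arith₂ r d)) ⟩
    qp2 (2 ℕ.* n) ⊛ (1-q²^ (suc (2 ℕ.* n)) ⊛ 1-q²^ (suc (suc (2 ℕ.* n))))
      ≈⟨ qp2-2+2n n ⟩
    qp2 (2 ℕ.* suc n)
      ∎
    where
    open ≋-Reasoning
    open SeriesSolver using (solve; _:*_; _:=_)
    n = suc (suc (r ℕ.+ d))
    K = n ℕ.+ r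
    g = 1+q²^ (suc (2 ℕ.* n))
    B = qp2 (suc (suc d)) ⊛ qp2 (suc (suc K))
    arith₁ : ∀ r d → suc (suc (r ℕ.+ d)) ≡ suc r ℕ.+ suc d
    arith₁ = solve-∀
    arith₂ : ∀ r d → 2 ℕ.* suc (suc (r ℕ.+ d)) ≡ suc (suc (d ℕ.+ (suc (suc (r ℕ.+ d)) ℕ.+ r)))
    arith₂ = solve-∀
    n∸r≡2+d : n ∸ r ≡ suc (suc d)
    n∸r≡2+d = ∸-≡ r (suc (suc d)) (P.sym (P.trans (NP.+-suc r (suc d)) (P.cong suc (NP.+-suc r d))))
    qd = qp2 d
    qK = qp2 K
    o₁ = 1-q²^ (suc d)
    o₂ = 1-q²^ (suc (suc d))
    oK₁ = 1-q²^ (suc K)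
    oK₂ = 1-q²^ (suc (suc K))
    factor₁ : B ≋ ((qp2 (suc d) ⊛ qp2 (suc K)) ⊛ (o₂ ⊛ oK₂))
    factor₁ = solve 6 (λ qd o₁ o₂ qK oK₁ oK₂ → ((qd :* o₁) :* o₂) :* ((qK :* oK₁) :* oK₂)
                                              := ((qd :* o₁) :* (qK :* oK₁)) :* (o₂ :* oK₂)) ≋.refl qd o₁ o₂ qK oK₁ oK₂
    factor₂ : B ≋ ((qp2 (suc (suc d)) ⊛ qK) ⊛ (oK₁ ⊛ oK₂))
    factor₂ = solve 6 (λ qd o₁ o₂ qK oK₁ oK₂ → ((qd :* o₁) :* o₂) :* ((qK :* oK₁) :* oK₂)
                                              := (((qd :* o₁) :* o₂) :* qK) :* (oK₁ :* oK₂)) ≋.refl qd o₁ o₂ qK oK₁ oK₂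
    factor₃ : B ≋ ((qd ⊛ qp2 (suc (suc K))) ⊛ (o₁ ⊛ o₂))
    factor₃ = solve 6 (λ qd o₁ o₂ qK oK₁ oK₂ → ((qd :* o₁) :* o₂) :* ((qK :* oK₁) :* oK₂)
                                              := (qd :* ((qK :* oK₁) :* oK₂)) :* (o₁ :* o₂)) ≋.refl qd o₁ o₂ qK oK₁ oK₂

  closed-form-subdiagonal : ∀ r → ClosedForm (suc r) → cbinomQ (suc (suc r)) (suc r) ≋ qp2 (2 ℕ.* suc (suc r))
  closed-form-subdiagonal r IH = begin
    cbinomQ (suc n) (suc r)
      ≈⟨ cbinomQ≋ {suc n} {suc r} n∸r≡1 (P.cong suc (NP.+-suc n r)) ⟩
    cbinom (suc n) (suc r) ⊛ B
      ≈⟨ ≋.*-congʳ {B} (≋.trans (≋.+-congˡ {(g ⊛ cbinom n (suc r)) ⊕ (q²^ (n ∸ r) ⊛ cbinom n r)}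
                                   (⊛-zeroS (q²^ (suc (suc K))) (cbinom-above n (suc (suc r)) (NP.n<1+n n))))
                                 (≋.trans (≋.+-identityʳ _) (≋.+-congˡ {g ⊛ cbinom n (suc r)} (≋.*-congʳ {cbinom n r} (q²^-≡ n∸r≡1))))) ⟩
    ((g ⊛ cbinom n (suc r)) ⊕ (q²^ 1 ⊛ cbinom n r)) ⊛ B
      ≈⟨ transfer₂ g (q²^ 1) {cbinom n (suc r)} {oneS} {qp2 (suc K)} {o₁ ⊛ oK₂}
                             {cbinom n r} {qp2 1} {qK} {oK₁ ⊛ oK₂}
           (closed-form-at IH (suc r) NP.≤-refl (NP.n∸n≡0 n) (NP.+-suc n r)) factor₁
           (closed-form-at IH r (NP.n≤1+n r) n∸r≡1 P.refl) factor₂ ⟩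
    qp2 (2 ℕ.* n) ⊛ ((g ⊛ (o₁ ⊛ oK₂)) ⊕ (q²^ 1 ⊛ (oK₁ ⊛ oK₂)))
      ≈⟨ ≋.*-congˡ {qp2 (2 ℕ.* n)} (subdiagonal-coefficients K (2 ℕ.* n) (arith r)) ⟩
    qp2 (2 ℕ.* n) ⊛ (1-q²^ (suc (2 ℕ.* n)) ⊛ 1-q²^ (suc (suc (2 ℕ.* n))))
      ≈⟨ qp2-2+2n n ⟩
    qp2 (2 ℕ.* suc n)
      ∎
    where
    open ≋-Reasoning
    open SeriesSolver using (solve; _:*_; _:=_)
    n = suc r
    K = n ℕ.+ r
    g = 1+q²^ (suc (2 ℕ.* n))
    B = qp2 1 ⊛ qp2 (suc (suc K))
    qK = qp2 K
    o₁ = 1-q²^ 1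
    oK₁ = 1-q²^ (suc K)
    oK₂ = 1-q²^ (suc (suc K))
    arith : ∀ r → 2 ℕ.* suc r ≡ suc (suc r ℕ.+ r)
    arith = solve-∀
    n∸r≡1 : n ∸ r ≡ 1
    n∸r≡1 = ∸-≡ r 1 (NP.+-comm 1 r)
    factor₁ : B ≋ ((oneS ⊛ qp2 (suc K)) ⊛ (o₁ ⊛ oK₂))
    factor₁ = solve 4 (λ o₁ qK oK₁ oK₂ → (con (+ 1) :* o₁) :* ((qK :* oK₁) :* oK₂)
                                        := (con (+ 1) :* (qK :* oK₁)) :* (o₁ :* oK₂)) ≋.refl o₁ qK oK₁ oK₂
      where open SeriesSolver using (con)
    factor₂ : B ≋ ((qp2 1 ⊛ qK) ⊛ (oK₁ ⊛ oK₂))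
    factor₂ = solve 4 (λ o₁ qK oK₁ oK₂ → (con (+ 1) :* o₁) :* ((qK :* oK₁) :* oK₂)
                                        := ((con (+ 1) :* o₁) :* qK) :* (oK₁ :* oK₂)) ≋.refl o₁ qK oK₁ oK₂
      where open SeriesSolver using (con)

  closed-form-diagonal : ∀ n → ClosedForm n → cbinomQ (suc n) (suc n) ≋ qp2 (2 ℕ.* suc n)
  closed-form-diagonal n IH = begin
    cbinomQ (suc n) (suc n)
      ≈⟨ cbinomQ≋ {suc n} {suc n} (NP.n∸n≡0 n) (P.cong suc (NP.+-suc n n)) ⟩
    cbinom (suc n) (suc n) ⊛ B
      ≈⟨ ≋.*-congʳ {B} only-middle ⟩
    (q²^ (n ∸ n) ⊛ cbinom n n) ⊛ B
      ≈⟨ transfer₁ (q²^ (n ∸ n)) {cbinom n n} {oneS} {qp2 (n ℕ.+ n)} {o₁ ⊛ o₂}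
           (closed-form-at IH n NP.≤-refl (NP.n∸n≡0 n) P.refl) factor ⟩
    qp2 (2 ℕ.* n) ⊛ (q²^ (n ∸ n) ⊛ (o₁ ⊛ o₂))
      ≈⟨ ≋.*-congˡ {qp2 (2 ℕ.* n)} (≋.trans (≋.*-congʳ {o₁ ⊛ o₂} (q²^-≡ (NP.n∸n≡0 n)))
           (≋.trans (oneS-⊛ (o₁ ⊛ o₂)) (≋.*-cong (1-q^-≡ (P.cong (λ k → 2 ℕ.* suc k) n+n≡2n))
                                                 (1-q^-≡ (P.cong (λ k → 2 ℕ.* suc (suc k)) n+n≡2n))))) ⟩
    qp2 (2 ℕ.* n) ⊛ (1-q²^ (suc (2 ℕ.* n)) ⊛ 1-q²^ (suc (suc (2 ℕ.* n))))
      ≈⟨ qp2-2+2n n ⟩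
    qp2 (2 ℕ.* suc n)
      ∎
    where
    open ≋-Reasoning
    open SeriesSolver using (solve; _:*_; _:=_)
    B = oneS ⊛ qp2 (suc (suc (n ℕ.+ n)))
    o₁ = 1-q²^ (suc (n ℕ.+ n))
    o₂ = 1-q²^ (suc (suc (n ℕ.+ n)))
    factor : B ≋ ((oneS ⊛ qp2 (n ℕ.+ n)) ⊛ (o₁ ⊛ o₂))
    factor = solve 3 (λ q o₁ o₂ → 1ₑ :* ((q :* o₁) :* o₂) := (1ₑ :* q) :* (o₁ :* o₂)) ≋.refl (qp2 (n ℕ.+ n)) o₁ o₂
    n+n≡2n : n ℕ.+ n ≡ 2 ℕ.* n
    n+n≡2n = P.cong (n ℕ.+_) (P.sym (NP.+-identityʳ n))
    only-middle : cbinom (suc n) (suc n) ≋ (q²^ (n ∸ n) ⊛ cbinom n n)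
    only-middle = ≋.trans
      (≋.+-cong (≋.+-cong (⊛-zeroS (1+q²^ (suc (2 ℕ.* n))) (cbinom-above n (suc n) (NP.n<1+n n))) ≋.refl)
                (⊛-zeroS (q²^ (suc (suc (n ℕ.+ n)))) (cbinom-above n (suc (suc n)) (NP.m<n⇒m<1+n (NP.n<1+n n)))))
      (≋.trans (≋.+-identityʳ _) (≋.+-identityˡ _))

  closed-form-edge : ∀ n′ → ClosedForm (suc n′) → cbinomQ (suc (suc n′)) 0 ≋ qp2 (2 ℕ.* suc (suc n′))
  closed-form-edge n′ IH = begin
    cbinomQ (suc n) 0
      ≈⟨ cbinomQ≋ {suc n} {0} P.refl (NP.+-identityʳ (suc n)) ⟩
    cbinom (suc n) 0 ⊛ B
      ≈⟨ transfer₂ (1+q²^ (suc (2 ℕ.* n))) (q²^ (suc n) ⊕ q²^ (suc n))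
           {cbinom n 0} {qp2 n} {qp2 n} {o₊ ⊛ o₊} {cbinom n 1} {qp2 n′} {qp2 (suc n)} {o ⊛ o₊}
           (closed-form-at IH 0 z≤n P.refl (NP.+-identityʳ n)) factor₀
           (closed-form-at IH 1 (s≤s z≤n) P.refl (NP.+-comm n 1)) factor₁ ⟩
    qp2 (2 ℕ.* n) ⊛ ((1+q²^ (suc (2 ℕ.* n)) ⊛ (o₊ ⊛ o₊)) ⊕ ((q²^ (suc n) ⊕ q²^ (suc n)) ⊛ (o ⊛ o₊)))
      ≈⟨ ≋.*-congˡ {qp2 (2 ℕ.* n)} (edge-coefficients n) ⟩
    qp2 (2 ℕ.* n) ⊛ (1-q²^ (suc (2 ℕ.* n)) ⊛ 1-q²^ (suc (suc (2 ℕ.* n))))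
      ≈⟨ qp2-2+2n n ⟩
    qp2 (2 ℕ.* suc n)
      ∎
    where
    open ≋-Reasoning
    open SeriesSolver using (solve; _:*_; _:=_)
    n = suc n′
    B = qp2 (suc n) ⊛ qp2 (suc n)
    o = 1-q²^ n
    o₊ = 1-q²^ (suc n)
    factor₀ : B ≋ ((qp2 n ⊛ qp2 n) ⊛ (o₊ ⊛ o₊))
    factor₀ = solve 2 (λ q o₊ → (q :* o₊) :* (q :* o₊) := (q :* q) :* (o₊ :* o₊)) ≋.refl (qp2 n) o₊
    factor₁ : B ≋ ((qp2 n′ ⊛ qp2 (suc n)) ⊛ (o ⊛ o₊))
    factor₁ = solve 4 (λ q′ o o₊ Q → ((q′ :* o) :* o₊) :* Q := (q′ :* Q) :* (o :* o₊)) ≋.refl (qp2 n′) o o₊ (qp2 (suc n))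

  closed-form-1-0 : cbinomQ 1 0 ≋ qp2 2
  closed-form-1-0 = ≋.trans
    (solve 1 (λ a → (((1ₑ :+ a) :* 1ₑ :+ (a :+ a) :* con (+ 0)) :* (1ₑ :* (1ₑ :- a))) :* (1ₑ :* (1ₑ :- a))
                    := (1ₑ :* (1ₑ :- a)) :* (1ₑ :- a :* a)) ≋.refl (q²^ 1))
    (≋.*-congˡ {oneS ⊛ 1-q²^ 1} (1⊖-cong (≋.sym (q²^-+ 1 1))))
    where
    open SeriesSolver using (solve; _:+_; _:*_; _:-_; _:=_; con)

  cbinom-closed-form : ∀ n → ClosedForm n
  cbinom-closed-form zero           zero    _ = ≋.trans (≋.*-identityʳ (oneS ⊛ oneS)) (≋.*-identityʳ oneS)
  cbinom-closed-form (suc zero)     zero    _ = closed-form-1-0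
  cbinom-closed-form (suc (suc n′)) zero    _ = closed-form-edge n′ (cbinom-closed-form (suc n′))
  cbinom-closed-form (suc n)        (suc r) (s≤s r≤n) with r ℕ.≟ n
  ... | yes P.refl = closed-form-diagonal r (cbinom-closed-form r)
  ... | no r≢n with suc r ℕ.≟ n
  ...   | yes P.refl = closed-form-subdiagonal r (cbinom-closed-form (suc r))
  ...   | no 1+r≢n = P.subst (λ n → ClosedForm n → cbinomQ (suc n) (suc r) ≋ qp2 (2 ℕ.* suc n))
                       (NP.m+[n∸m]≡n r+2≤n) (closed-form-interior r (n ∸ suc (suc r))) (cbinom-closed-form n)
    where
    r+2≤n : suc (suc r) ≤ n
    r+2≤n = NP.≤∧≢⇒< (NP.≤∧≢⇒< r≤n r≢n) 1+r≢n

  n≤[1+c]n² : ∀ c n → n ≤ suc c ℕ.* (n ℕ.* n)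
  n≤[1+c]n² c zero    = z≤n
  n≤[1+c]n² c (suc n) = NP.≤-trans (NP.m≤m*n (suc n) (suc n)) (NP.m≤m+n (suc n ℕ.* suc n) (c ℕ.* (suc n ℕ.* suc n)))

  -- the summand of bailey-lemma once (q²;q²)_{m-n} has become (q²;q²)_∞
  limitTerm : ℕ → ℕ → PS
  limitTerm r t = (mono (2 ℕ.* ((r ℕ.+ t) ℕ.* (r ℕ.+ t))) ⊛ qp2⁻¹ t) ⊛ qp2⁻¹ (2 ℕ.* r ℕ.+ t)

  limitTerm-vanish : ∀ r t → vanish (r ℕ.+ t) (limitTerm r t)
  limitTerm-vanish r t = vanish-weaken (n≤[1+c]n² 1 (r ℕ.+ t))
    (vanish-⊛ʳ e (mono e ⊛ qp2⁻¹ t) (qp2⁻¹ (2 ℕ.* r ℕ.+ t)) (vanish-mono e (qp2⁻¹ t)))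
    where e = 2 ℕ.* ((r ℕ.+ t) ℕ.* (r ℕ.+ t))

  limitSum-pad : ∀ r N L K → N < r ℕ.+ L → ΣS< (L ℕ.+ K) (limitTerm r) ≈[ N ] ΣS< L (limitTerm r)
  limitSum-pad r N L K N<r+L n n≤N = Σ-pad L (L ℕ.+ K) (λ t → limitTerm r t n) (NP.m≤m+n L K)
    (λ t L≤t _ → limitTerm-vanish r t n (NP.≤-<-trans n≤N (NP.<-≤-trans N<r+L (NP.+-monoʳ-≤ r L≤t))))

  limitSum-length : ∀ r N L L′ → N < r ℕ.+ L → N < r ℕ.+ L′ → ΣS< L (limitTerm r) ≈[ N ] ΣS< L′ (limitTerm r)
  limitSum-length r N L L′ N<r+L N<r+L′ = ≈[]-trans (≈[]-sym (limitSum-pad r N L L′ N<r+L))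
    (≈[]-trans (λ n _ → reflexive (P.cong (λ k → ΣS< k (limitTerm r) n) (NP.+-comm L L′))) (limitSum-pad r N L′ L N<r+L′))

  baileyTerm≈[]limitTerm : ∀ r N t → baileyTerm (r ℕ.+ (N ℕ.+ N)) r t ≈[ N ] (qp2∞⁻¹ ⊛ limitTerm r t)
  baileyTerm≈[]limitTerm r N t with t ℕ.≤? N
  ... | yes t≤N = ≈[]-trans
    (≈[]-⊛ (≈[]-⊛ (≈[]-⊛ (≈[]-refl {f = mono e}) (qp2⁻¹≈[]qp2∞⁻¹ (m ∸ (r ℕ.+ t)) N N≤m∸[r+t]))
                    (≈[]-refl {f = qp2⁻¹ t})) (≈[]-refl {f = qp2⁻¹ (2 ℕ.* r ℕ.+ t)}))
    (≋⇒≈[] (solve 4 (λ a b c d → ((a :* b) :* c) :* d := b :* ((a :* c) :* d)) ≋.refl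
              (mono e) qp2∞⁻¹ (qp2⁻¹ t) (qp2⁻¹ (2 ℕ.* r ℕ.+ t))))
    where
    open SeriesSolver using (solve; _:*_; _:=_)
    m = r ℕ.+ (N ℕ.+ N)
    e = 2 ℕ.* ((r ℕ.+ t) ℕ.* (r ℕ.+ t))
    N≤m∸[r+t] : N ≤ m ∸ (r ℕ.+ t)
    N≤m∸[r+t] = P.subst (N ≤_) (P.sym (P.trans (NP.[m+n]∸[m+o]≡n∸o r (N ℕ.+ N) t) (NP.+-∸-assoc N t≤N)))
                        (NP.m≤m+n N (N ∸ t))
  ... | no t≰N = ≈[]-trans
    (vanish⇒≈[]0 (vanish-weaken N<r+t (vanish-weaken (n≤[1+c]n² 1 (r ℕ.+ t))
      (vanish-⊛ʳ e ((mono e ⊛ qp2⁻¹ (m ∸ (r ℕ.+ t))) ⊛ qp2⁻¹ t) (qp2⁻¹ (2 ℕ.* r ℕ.+ t))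
        (vanish-⊛ʳ e (mono e ⊛ qp2⁻¹ (m ∸ (r ℕ.+ t))) (qp2⁻¹ t) (vanish-mono e (qp2⁻¹ (m ∸ (r ℕ.+ t)))))))))
    (≈[]-sym (vanish⇒≈[]0 (vanish-weaken N<r+t (vanish-⊛ˡ (r ℕ.+ t) qp2∞⁻¹ (limitTerm r t) (limitTerm-vanish r t)))))
    where
    m = r ℕ.+ (N ℕ.+ N)
    e = 2 ℕ.* ((r ℕ.+ t) ℕ.* (r ℕ.+ t))
    N<r+t : suc N ≤ r ℕ.+ t
    N<r+t = NP.≤-trans (NP.≰⇒> t≰N) (NP.m≤n+m t r)

  qp2∞⁻¹-cancel : ∀ {N f g} → (qp2∞⁻¹ ⊛ f) ≈[ N ] (g ⊛ qp2∞⁻¹) → f ≈[ N ] g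
  qp2∞⁻¹-cancel {N} {f} {g} f≈g = ≈[]-trans (≋⇒≈[] (≋.sym cancel-left))
    (≈[]-trans (≈[]-⊛ (≈[]-refl {f = qp2∞}) f≈g) (≋⇒≈[] cancel-right))
    where
    open SeriesSolver using (solve; _:*_; _:=_)
    cancel-left : (qp2∞ ⊛ (qp2∞⁻¹ ⊛ f)) ≋ f
    cancel-left = ≋.trans (≋.sym (≋.*-assoc qp2∞ qp2∞⁻¹ f))
      (≋.trans (≋.*-congʳ {f} (≋.trans (≋.*-comm qp2∞ qp2∞⁻¹) qp2∞⁻¹-inverse)) (≋.*-identityˡ f))
    cancel-right : (qp2∞ ⊛ (g ⊛ qp2∞⁻¹)) ≋ g
    cancel-right = ≋.trans (solve 3 (λ q g i → q :* (g :* i) := g :* (i :* q)) ≋.refl qp2∞ g qp2∞⁻¹)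
      (≋.trans (≋.*-congˡ {g} qp2∞⁻¹-inverse) (≋.*-identityʳ g))

  -- Letting m → ∞ in bailey-lemma: both sides agree below degree N once m ≥ r + 2N.
  bailey-limit : ∀ r N L → N < r ℕ.+ L → ΣS< L (limitTerm r) ≈[ N ] (mono (2 ℕ.* (r ℕ.* r)) ⊛ qp2∞⁻¹)
  bailey-limit r N L N<r+L =
    ≈[]-trans (limitSum-length r N L (suc M) N<r+L (NP.≤-trans (s≤s (NP.m≤m+n N N)) (NP.m≤n+m (suc M) r)))
      (qp2∞⁻¹-cancel (≈[]-trans (≋⇒≈[] (⊛-ΣS (suc M) qp2∞⁻¹ (limitTerm r)))
        (≈[]-trans (≈[]-ΣS (suc M) (λ t _ → ≈[]-sym (baileyTerm≈[]limitTerm r N t)))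
          (≈[]-trans (≋⇒≈[] finite) finite≈[]))))
    where
    M = N ℕ.+ N
    m = r ℕ.+ M
    q^2r² = mono (2 ℕ.* (r ℕ.* r))
    finite : ΣS< (suc M) (baileyTerm m r) ≋ ((q^2r² ⊛ qp2⁻¹ M) ⊛ qp2⁻¹ (m ℕ.+ r))
    finite = P.subst (λ k → ΣS< (suc k) (baileyTerm m r) ≋ ((q^2r² ⊛ qp2⁻¹ k) ⊛ qp2⁻¹ (m ℕ.+ r)))
               (NP.m+n∸m≡n r M) (bailey-lemma m r (NP.m≤m+n r M))
    finite≈[] : ((q^2r² ⊛ qp2⁻¹ M) ⊛ qp2⁻¹ (m ℕ.+ r)) ≈[ N ] ((q^2r² ⊛ qp2∞⁻¹) ⊛ qp2∞⁻¹)
    finite≈[] = ≈[]-⊛ (≈[]-⊛ (≈[]-refl {f = q^2r²}) (qp2⁻¹≈[]qp2∞⁻¹ M N (NP.m≤m+n N N)))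
                      (qp2⁻¹≈[]qp2∞⁻¹ (m ℕ.+ r) N (NP.≤-trans (NP.m≤m+n N N) (NP.≤-trans (NP.m≤n+m M r) (NP.m≤m+n m r))))

  cst : Carrier → PS
  cst a = scale a oneS

  cst-⊛ : ∀ a f → (cst a ⊛ f) ≋ scale a f
  cst-⊛ a f n = trans (Σ-cong′ (suc n) (λ i → trans (*-congʳ (*-comm a (mono 0 i))) (*-assoc (mono 0 i) a (f (n ∸ i)))))
                      (Σ-δ (suc n) 0 (λ i → a * f (n ∸ i)))

  cst-cong : ∀ {a b} → a ≈ b → cst a ≋ cst b
  cst-cong a≈b n = *-congʳ a≈b

  cst-+ : ∀ a b → cst (a + b) ≋ (cst a ⊕ cst b)
  cst-+ a b n = distribʳ _ _ _

  cst-* : ∀ a b → cst (a * b) ≋ (cst a ⊛ cst b)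
  cst-* a b = ≋.sym (≋.trans (cst-⊛ a (cst b)) (λ n → sym (*-assoc _ _ _)))

  term : Carrier → ℕ → PS
  term a e = cst a ⊛ mono e

  term-cong : ∀ {a b e e′} → a ≈ b → e ≡ e′ → term a e ≋ term b e′
  term-cong {e = e} a≈b P.refl = ≋.*-congʳ {mono e} (cst-cong a≈b)

  term-⊛ : ∀ a e b e′ → (term a e ⊛ term b e′) ≋ term (a * b) (e ℕ.+ e′)
  term-⊛ a e b e′ = ≋.trans
    (solve 4 (λ A E B E′ → (A :* E) :* (B :* E′) := (A :* B) :* (E :* E′)) ≋.refl (cst a) (mono e) (cst b) (mono e′))
    (≋.*-cong (≋.sym (cst-* a b)) (mono-+ e e′))
    where open SeriesSolver using (solve; _:*_; _:=_)

  term-+ : ∀ a b e → (term a e ⊕ term b e) ≋ term (a + b) e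
  term-+ a b e = ≋.trans (≋.sym (≋.distribʳ (mono e) (cst a) (cst b))) (≋.*-congʳ {mono e} (≋.sym (cst-+ a b)))

  scale-mono : ∀ a e → scale a (mono e) ≋ term a e
  scale-mono a e = ≋.sym (cst-⊛ a (mono e))

  q²^≋term : ∀ e → q²^ e ≋ term 1# (2 ℕ.* e)
  q²^≋term e = ≋.sym (≋.trans (≋.*-congʳ {mono (2 ℕ.* e)} (λ n → *-identityˡ _)) (≋.*-identityˡ (mono (2 ℕ.* e))))

  module _ (x : Carrier) where
    private
      module RS = IntegerRingSolver R

    α : ℕ → PS
    α r = scale (W x r) (mono (r ℕ.* r))

    2xq^ : ℕ → PS
    2xq^ e = cst (two * x) ⊛ mono e

    αUp : ℕ → ℕ → PS
    αUp n j = α (suc j) ⊛ q²^ (n ∸ j)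

    αDown : ℕ → ℕ → PS
    αDown n 0             = zeroS
    αDown n 1             = α 0 ⊛ (q²^ (suc n) ⊕ q²^ (suc n))
    αDown n (suc (suc r)) = α (suc r) ⊛ q²^ (suc (suc (n ℕ.+ r)))

    α-term : ∀ j e → (α j ⊛ q²^ e) ≋ term (W x j * 1#) (j ℕ.* j ℕ.+ 2 ℕ.* e)
    α-term j e = ≋.trans (≋.*-cong (scale-mono (W x j) (j ℕ.* j)) (q²^≋term e)) (term-⊛ (W x j) (j ℕ.* j) 1# (2 ℕ.* e))

    α-2xq^ : ∀ n j → (α j ⊛ 2xq^ (suc (2 ℕ.* n))) ≋ term (W x j * (two * x)) (j ℕ.* j ℕ.+ suc (2 ℕ.* n))
    α-2xq^ n j = ≋.trans (≋.*-congʳ {2xq^ (suc (2 ℕ.* n))} (scale-mono (W x j) (j ℕ.* j)))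
                         (term-⊛ (W x j) (j ℕ.* j) (two * x) (suc (2 ℕ.* n)))

    -- 2x (V_j + V_{j-1}) = (V_{j+1} + V_j) + (V_{j-1} + V_{j-2}), read off as exponents of q
    α-recurrence : ∀ n j → j ≤ n → (α j ⊛ 2xq^ (suc (2 ℕ.* n))) ≋ (αUp n j ⊕ αDown n j)
    α-recurrence n zero _ =
      ≋.trans (α-2xq^ n 0) (≋.trans (term-cong W₁ (arith n)) (≋.sym (≋.trans (≋.+-identityʳ (αUp n 0)) (α-term 1 n))))
      where
      open RS using (solve; _:+_; _:*_; _:-_; _:=_; con)
      arith : ∀ n → 0 ℕ.+ suc (2 ℕ.* n) ≡ 1 ℕ.+ 2 ℕ.* n
      arith = solve-∀
      W₁ : W x 0 * (two * x) ≈ W x 1 * 1#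
      W₁ = solve 1 (λ X → con (+ 1) :* ((con (+ 1) :+ con (+ 1)) :* X)
                          := (((con (+ 1) :+ con (+ 1)) :* X :- con (+ 1)) :+ con (+ 1)) :* con (+ 1)) refl x
    α-recurrence (suc m) (suc zero) _ =
      ≋.trans (α-2xq^ (suc m) 1)
        (≋.trans (term-cong W₂ (arith₁ m))
          (≋.sym (≋.trans (≋.+-cong (α-term 2 m) down) (term-+ (W x 2 * 1#) (W x 0 * (1# + 1#)) (4 ℕ.+ 2 ℕ.* m)))))
      where
      open RS using (solve; _:+_; _:*_; _:-_; _:=_; con)
      arith₁ : ∀ m → 1 ℕ.+ suc (2 ℕ.* suc m) ≡ 4 ℕ.+ 2 ℕ.* m
      arith₁ = solve-∀
      arith₂ : ∀ m → 0 ℕ.+ 2 ℕ.* suc (suc m) ≡ 4 ℕ.+ 2 ℕ.* m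
      arith₂ = solve-∀
      W₂ : W x 1 * (two * x) ≈ W x 2 * 1# + W x 0 * (1# + 1#)
      W₂ = solve 1 (λ X → ((t :* X :- 1ᵣ) :+ 1ᵣ) :* (t :* X)
                          := ((t :* X :* (t :* X :- 1ᵣ) :- 1ᵣ) :+ (t :* X :- 1ᵣ)) :* 1ᵣ :+ 1ᵣ :* t) refl x
        where 1ᵣ = con (+ 1)
              t = con (+ 1) :+ con (+ 1)
      down : αDown (suc m) 1 ≋ term (W x 0 * (1# + 1#)) (4 ℕ.+ 2 ℕ.* m)
      down = ≋.trans (≋.*-cong (scale-mono (W x 0) 0)
                               (≋.trans (≋.+-cong (q²^≋term (suc (suc m))) (q²^≋term (suc (suc m)))) (term-+ 1# 1# (2 ℕ.* suc (suc m)))))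
                     (≋.trans (term-⊛ (W x 0) 0 (1# + 1#) (2 ℕ.* suc (suc m))) (term-cong refl (arith₂ m)))
    α-recurrence n (suc (suc j)) j+2≤n =
      P.subst (λ n → (α (suc (suc j)) ⊛ 2xq^ (suc (2 ℕ.* n))) ≋ (αUp n (suc (suc j)) ⊕ αDown n (suc (suc j))))
              (NP.m+[n∸m]≡n j+2≤n) (at (n ∸ suc (suc j)))
      where
      open RS using (solve; _:+_; _:*_; _:-_; _:=_; con)
      W₃ : W x (suc (suc j)) * (two * x) ≈ W x (suc (suc (suc j))) * 1# + W x (suc j) * 1#
      W₃ = solve 3 (λ X A B → ((t :* X :* A :- B) :+ A) :* (t :* X)
                              := ((t :* X :* (t :* X :* A :- B) :- A) :+ (t :* X :* A :- B)) :* 1ᵣ :+ (A :+ B) :* 1ᵣ)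
                   refl x (V x (suc j)) (V x j)
        where 1ᵣ = con (+ 1)
              t = con (+ 1) :+ con (+ 1)
      arith₁ : ∀ j d → suc (suc j) ℕ.* suc (suc j) ℕ.+ suc (2 ℕ.* (suc (suc j) ℕ.+ d))
                       ≡ suc (suc (suc j)) ℕ.* suc (suc (suc j)) ℕ.+ 2 ℕ.* d
      arith₁ = solve-∀
      arith₂ : ∀ j d → suc (suc j) ℕ.* suc (suc j) ℕ.+ suc (2 ℕ.* (suc (suc j) ℕ.+ d))
                       ≡ suc j ℕ.* suc j ℕ.+ 2 ℕ.* suc (suc ((suc (suc j) ℕ.+ d) ℕ.+ j))
      arith₂ = solve-∀
      at : ∀ d → let n = suc (suc j) ℕ.+ d in
           (α (suc (suc j)) ⊛ 2xq^ (suc (2 ℕ.* n))) ≋ (αUp n (suc (suc j)) ⊕ αDown n (suc (suc j)))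
      at d = ≋.trans (α-2xq^ n′ (suc (suc j))) (≋.trans (term-cong {e = e} W₃ P.refl) (≋.sym (≋.trans
               (≋.+-cong (α-term (suc (suc (suc j))) (n′ ∸ suc (suc j))) (α-term (suc j) (suc (suc (n′ ℕ.+ j)))))
               (≋.trans (≋.+-cong (term-cong refl (P.trans (P.cong (λ k → suc (suc (suc j)) ℕ.* suc (suc (suc j)) ℕ.+ 2 ℕ.* k)
                                                                     (NP.m+n∸m≡n (suc (suc j)) d))
                                                            (P.sym (arith₁ j d))))
                                  (term-cong refl (P.sym (arith₂ j d))))
                        (term-+ (W x (suc (suc (suc j))) * 1#) (W x (suc j) * 1#) e)))))
        where
        n′ = suc (suc j) ℕ.+ d
        e = suc (suc j) ℕ.* suc (suc j) ℕ.+ suc (2 ℕ.* n′)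

    Σαcbinom : ℕ → PS
    Σαcbinom n = ΣS< (suc n) (λ r → α r ⊛ cbinom n r)

    P-factor≋ : ∀ n → ((oneS ⊕ scale (two * x) (mono (2 ℕ.* suc n ∸ 1))) ⊕ mono (4 ℕ.* suc n ∸ 2))
                      ≋ (1+q²^ (suc (2 ℕ.* n)) ⊕ 2xq^ (suc (2 ℕ.* n)))
    P-factor≋ n = ≋.trans
      (≋.+-cong (≋.+-congˡ {oneS} (≋.trans (scale-mono (two * x) (2 ℕ.* suc n ∸ 1)) (term-cong refl (P.cong (_∸ 1) (arith₁ n)))))
                (mono-≡ (P.cong (_∸ 2) (arith₂ n))))
      (solve 3 (λ o h q → (o :+ h) :+ q := (o :+ q) :+ h) ≋.refl oneS (2xq^ (suc (2 ℕ.* n))) (q²^ (suc (2 ℕ.* n))))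
      where
      open SeriesSolver using (solve; _:+_; _:=_)
      arith₁ : ∀ n → 2 ℕ.* suc n ≡ 1 ℕ.+ suc (2 ℕ.* n)
      arith₁ = solve-∀
      arith₂ : ∀ n → 4 ℕ.* suc n ≡ 2 ℕ.+ 2 ℕ.* suc (2 ℕ.* n)
      arith₂ = solve-∀

    Σαcbinom-⊛-2xq^ : ∀ n → (Σαcbinom n ⊛ 2xq^ (suc (2 ℕ.* n)))
                              ≋ (ΣS< (suc n) (λ j → αDown n j ⊛ cbinom n j) ⊕ ΣS< (suc n) (λ j → αUp n j ⊛ cbinom n j))
    Σαcbinom-⊛-2xq^ n = ≋.trans (ΣS-⊛ (suc n) (λ r → α r ⊛ cbinom n r) h)
      (≋.trans (ΣS-cong (suc n) split) (ΣS-+ (suc n) (λ j → αDown n j ⊛ cbinom n j) (λ j → αUp n j ⊛ cbinom n j)))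
      where
      open SeriesSolver using (solve; _:*_; _:=_)
      h = 2xq^ (suc (2 ℕ.* n))
      split : ∀ j → j < suc n → ((α j ⊛ cbinom n j) ⊛ h) ≋ ((αDown n j ⊛ cbinom n j) ⊕ (αUp n j ⊛ cbinom n j))
      split j j≤n = ≋.trans (solve 3 (λ A D H → (A :* D) :* H := (A :* H) :* D) ≋.refl (α j) (cbinom n j) h)
        (≋.trans (≋.*-congʳ {cbinom n j} (α-recurrence n j (NP.≤-pred j≤n)))
                 (≋.trans (≋.distribʳ (cbinom n j) (αUp n j) (αDown n j)) (≋.+-comm _ _)))

    Σαcbinom-suc : ∀ n → Σαcbinom (suc n)
      ≋ ((1+q²^ (suc (2 ℕ.* n)) ⊛ Σαcbinom n)
          ⊕ (ΣS< (suc n) (λ j → αDown n j ⊛ cbinom n j) ⊕ ΣS< (suc n) (λ j → αUp n j ⊛ cbinom n j)))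
    Σαcbinom-suc n = begin
      Σαcbinom (suc n)
        ≈⟨ ΣS-front (suc n) (λ r → α r ⊛ cbinom (suc n) r) ⟩
      (α 0 ⊛ cbinom (suc n) 0) ⊕ ΣS< (suc n) (λ r → α (suc r) ⊛ cbinom (suc n) (suc r))
        ≈⟨ ≋.+-cong head (ΣS-cong (suc n) (λ r _ → tail r)) ⟩
      ((g ⊛ A₀) ⊕ down 1) ⊕ ΣS< (suc n) (λ r → (g ⊛ (α (suc r) ⊛ cbinom n (suc r))) ⊕ (up r ⊕ down (suc (suc r))))
        ≈⟨ ≋.+-congˡ {(g ⊛ A₀) ⊕ down 1} (≋.trans (ΣS-+ (suc n) _ _)
             (≋.+-cong (≋.sym (⊛-ΣS (suc n) g (λ r → α (suc r) ⊛ cbinom n (suc r)))) (ΣS-+ (suc n) up (λ r → down (suc (suc r)))))) ⟩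
      ((g ⊛ A₀) ⊕ down 1) ⊕ ((g ⊛ C) ⊕ (Σup ⊕ Σdown₂))
        ≈⟨ solve 6 (λ g a₀ b₁ c u d → ((g :* a₀) :+ b₁) :+ ((g :* c) :+ (u :+ d)) := (g :* (a₀ :+ c)) :+ ((b₁ :+ d) :+ u))
             ≋.refl g A₀ (down 1) C Σup Σdown₂ ⟩
      (g ⊛ (A₀ ⊕ C)) ⊕ ((down 1 ⊕ Σdown₂) ⊕ Σup)
        ≈⟨ ≋.+-cong (≋.*-congˡ {g} old-sum) (≋.+-congʳ {Σup} down-sum) ⟩
      (g ⊛ Σαcbinom n) ⊕ (ΣS< (suc n) down ⊕ Σup)
        ∎
      where
      open ≋-Reasoning
      open SeriesSolver using (solve; _:+_; _:*_; _:=_)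
      g = 1+q²^ (suc (2 ℕ.* n))
      up = λ j → αUp n j ⊛ cbinom n j
      down = λ j → αDown n j ⊛ cbinom n j
      A₀ = α 0 ⊛ cbinom n 0
      C = ΣS< (suc n) (λ r → α (suc r) ⊛ cbinom n (suc r))
      Σup = ΣS< (suc n) up
      Σdown₂ = ΣS< (suc n) (λ r → down (suc (suc r)))
      head : (α 0 ⊛ cbinom (suc n) 0) ≋ ((g ⊛ A₀) ⊕ down 1)
      head = solve 5 (λ A g D₀ Q D₁ → A :* ((g :* D₀) :+ (Q :* D₁)) := (g :* (A :* D₀)) :+ ((A :* Q) :* D₁)) ≋.refl
               (α 0) g (cbinom n 0) (q²^ (suc n) ⊕ q²^ (suc n)) (cbinom n 1)
      tail : ∀ r → (α (suc r) ⊛ cbinom (suc n) (suc r)) ≋ ((g ⊛ (α (suc r) ⊛ cbinom n (suc r))) ⊕ (up r ⊕ down (suc (suc r))))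
      tail r = solve 7 (λ A g D₁ Q₀ D₀ Q₂ D₂ → A :* (((g :* D₁) :+ (Q₀ :* D₀)) :+ (Q₂ :* D₂))
                                               := (g :* (A :* D₁)) :+ (((A :* Q₀) :* D₀) :+ ((A :* Q₂) :* D₂))) ≋.refl
                 (α (suc r)) g (cbinom n (suc r)) (q²^ (n ∸ r)) (cbinom n r) (q²^ (suc (suc (n ℕ.+ r)))) (cbinom n (suc (suc r)))
      old-sum : (A₀ ⊕ C) ≋ Σαcbinom n
      old-sum = ≋.trans (≋.sym (ΣS-front (suc n) (λ r → α r ⊛ cbinom n r)))
                  (ΣS-pad (suc n) (suc (suc n)) (λ r → α r ⊛ cbinom n r) (NP.n≤1+n _)
                          (λ i n<i _ → ⊛-zeroS (α i) (cbinom-above n i n<i)))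
      down-sum : (down 1 ⊕ Σdown₂) ≋ ΣS< (suc n) down
      down-sum = ≋.sym (≋.trans
        (≋.sym (ΣS-pad (suc n) (suc (suc (suc n))) down (NP.≤-trans (NP.n≤1+n _) (NP.n≤1+n _))
                       (λ i n<i _ → ⊛-zeroS (αDown n i) (cbinom-above n i n<i))))
        (≋.trans (ΣS-front (suc (suc n)) down)
          (≋.trans (≋.+-congʳ {ΣS< (suc (suc n)) (λ j → down (suc j))} (≋.zeroˡ (cbinom n 0)))
            (≋.trans (≋.+-identityˡ _) (ΣS-front (suc n) (λ j → down (suc j)))))))

    P≋Σαcbinom : ∀ n → P x n ≋ Σαcbinom n
    P≋Σαcbinom zero    = ≋.sym (≋.trans (≋.+-identityˡ (α 0 ⊛ oneS)) (≋.trans (≋.*-identityʳ (α 0)) (λ k → *-identityˡ _)))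
    P≋Σαcbinom (suc n) = begin
      P x (suc n)
        ≈⟨ ≋.*-cong (P≋Σαcbinom n) (P-factor≋ n) ⟩
      Σαcbinom n ⊛ (g ⊕ h)
        ≈⟨ solve 3 (λ s g h → s :* (g :+ h) := (g :* s) :+ (s :* h)) ≋.refl (Σαcbinom n) g h ⟩
      (g ⊛ Σαcbinom n) ⊕ (Σαcbinom n ⊛ h)
        ≈⟨ ≋.+-congˡ {g ⊛ Σαcbinom n} (Σαcbinom-⊛-2xq^ n) ⟩
      (g ⊛ Σαcbinom n) ⊕ (ΣS< (suc n) (λ j → αDown n j ⊛ cbinom n j) ⊕ ΣS< (suc n) (λ j → αUp n j ⊛ cbinom n j))
        ≈⟨ ≋.sym (Σαcbinom-suc n) ⟩
      Σαcbinom (suc n)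
        ∎
      where
      open ≋-Reasoning
      open SeriesSolver using (solve; _:+_; _:*_; _:=_)
      g = 1+q²^ (suc (2 ℕ.* n))
      h = 2xq^ (suc (2 ℕ.* n))

    cbinom⊛qp2⁻¹ : ∀ m r → r ≤ m → (cbinom m r ⊛ qp2⁻¹ (2 ℕ.* m)) ≋ (qp2⁻¹ (m ∸ r) ⊛ qp2⁻¹ (m ℕ.+ r))
    cbinom⊛qp2⁻¹ m r r≤m = ≋.trans (≋.*-congʳ {qp2⁻¹ (2 ℕ.* m)} cbinom≋)
      (≋.trans (solve 4 (λ Q i₂ i₁ iQ → ((Q :* i₂) :* i₁) :* iQ := (iQ :* Q) :* (i₁ :* i₂)) ≋.refl
                  (qp2 (2 ℕ.* m)) (qp2⁻¹ (m ℕ.+ r)) (qp2⁻¹ (m ∸ r)) (qp2⁻¹ (2 ℕ.* m)))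
               (≋.trans (≋.*-congʳ {qp2⁻¹ (m ∸ r) ⊛ qp2⁻¹ (m ℕ.+ r)} (qp2⁻¹-inverse (2 ℕ.* m)))
                        (≋.*-identityˡ (qp2⁻¹ (m ∸ r) ⊛ qp2⁻¹ (m ℕ.+ r)))))
      where
      open SeriesSolver using (solve; _:*_; _:=_)
      cbinom≋ : cbinom m r ≋ ((qp2 (2 ℕ.* m) ⊛ qp2⁻¹ (m ℕ.+ r)) ⊛ qp2⁻¹ (m ∸ r))
      cbinom≋ = ⊛-transpose {u = qp2 (m ∸ r)} (qp2⁻¹-inverse (m ∸ r))
                  (⊛-transpose {u = qp2 (m ℕ.+ r)} (qp2⁻¹-inverse (m ℕ.+ r)) (cbinom-closed-form m r r≤m))

    bailey-pair : ∀ m → (P x m ⊛ qp2⁻¹ (2 ℕ.* m)) ≋ ΣS< (suc m) (λ r → α r ⊛ (qp2⁻¹ (m ∸ r) ⊛ qp2⁻¹ (m ℕ.+ r)))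
    bailey-pair m = ≋.trans (≋.*-congʳ {qp2⁻¹ (2 ℕ.* m)} (P≋Σαcbinom m))
      (≋.trans (ΣS-⊛ (suc m) (λ r → α r ⊛ cbinom m r) (qp2⁻¹ (2 ℕ.* m)))
               (ΣS-cong (suc m) (λ r r≤m → ≋.trans (≋.*-assoc (α r) (cbinom m r) (qp2⁻¹ (2 ℕ.* m)))
                                                 (≋.*-congˡ {α r} (cbinom⊛qp2⁻¹ m r (NP.≤-pred r≤m))))))

    αᵏ : ℕ → ℕ → PS
    αᵏ k r = mono (2 ℕ.* (k ℕ.* (r ℕ.* r))) ⊛ α r

    βᵏ : ℕ → ℕ → PS
    βᵏ k m = ΣS< (suc m) (λ r → αᵏ k r ⊛ (qp2⁻¹ (m ∸ r) ⊛ qp2⁻¹ (m ℕ.+ r)))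

    q^2r²⊛αᵏ : ∀ k r → (mono (2 ℕ.* (r ℕ.* r)) ⊛ αᵏ k r) ≋ αᵏ (suc k) r
    q^2r²⊛αᵏ k r = ≋.trans (≋.sym (≋.*-assoc (mono (2 ℕ.* (r ℕ.* r))) (mono (2 ℕ.* (k ℕ.* (r ℕ.* r)))) (α r)))
      (≋.*-congʳ {α r} (≋.trans (mono-+ (2 ℕ.* (r ℕ.* r)) (2 ℕ.* (k ℕ.* (r ℕ.* r)))) (mono-≡ (arith k r))))
      where
      arith : ∀ k r → 2 ℕ.* (r ℕ.* r) ℕ.+ 2 ℕ.* (k ℕ.* (r ℕ.* r)) ≡ 2 ℕ.* (suc k ℕ.* (r ℕ.* r))
      arith = solve-∀

    αᵏ-bailey : ∀ k m r → r ≤ m →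
      (αᵏ k r ⊛ ΣS< (suc (m ∸ r)) (baileyTerm m r)) ≋ (αᵏ (suc k) r ⊛ (qp2⁻¹ (m ∸ r) ⊛ qp2⁻¹ (m ℕ.+ r)))
    αᵏ-bailey k m r r≤m = ≋.trans (≋.*-congˡ {αᵏ k r} (bailey-lemma m r r≤m))
      (≋.trans (solve 4 (λ e a i₁ i₂ → a :* ((e :* i₁) :* i₂) := (e :* a) :* (i₁ :* i₂)) ≋.refl
                  (mono (2 ℕ.* (r ℕ.* r))) (αᵏ k r) (qp2⁻¹ (m ∸ r)) (qp2⁻¹ (m ℕ.+ r)))
               (≋.*-congʳ {qp2⁻¹ (m ∸ r) ⊛ qp2⁻¹ (m ℕ.+ r)} (q^2r²⊛αᵏ k r)))
      where open SeriesSolver using (solve; _:*_; _:=_)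

    chain≋ : ∀ k m → chain x (suc k) m ≋ (mono (2 ℕ.* (m ℕ.* m)) ⊛ βᵏ k m)
    chain≋ zero m = ≋.trans (≋.*-assoc (mono (2 ℕ.* (m ℕ.* m))) (P x m) (qp2⁻¹ (2 ℕ.* m)))
      (≋.*-congˡ {mono (2 ℕ.* (m ℕ.* m))} (≋.trans (bailey-pair m)
        (ΣS-cong (suc m) (λ r _ → ≋.*-congʳ {qp2⁻¹ (m ∸ r) ⊛ qp2⁻¹ (m ℕ.+ r)} (≋.sym (oneS-⊛ (α r)))))))
    chain≋ (suc k) m = begin
      chain x (suc (suc k)) m
        ≈⟨ ≋.*-congˡ {q^2m²} (ΣS-cong (suc m) (λ n _ → ≋.*-congˡ {qp2⁻¹ (m ∸ n)} (chain≋ k n))) ⟩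
      q^2m² ⊛ ΣS< (suc m) (λ n → qp2⁻¹ (m ∸ n) ⊛ (mono (2 ℕ.* (n ℕ.* n)) ⊛ βᵏ k n))
        ≈⟨ ≋.*-congˡ {q^2m²} (ΣS-cong (suc m) (λ n _ → expand n)) ⟩
      q^2m² ⊛ ΣS< (suc m) (λ n → ΣS< (suc n) (λ r → F r n))
        ≈⟨ ≋.*-congˡ {q^2m²} (ΣS-triangle (suc m) F) ⟩
      q^2m² ⊛ ΣS< (suc m) (λ r → ΣS< (suc m ∸ r) (λ t → F r (r ℕ.+ t)))
        ≈⟨ ≋.*-congˡ {q^2m²} (ΣS-cong (suc m) (λ r r≤m → sum-over-n r (NP.≤-pred r≤m))) ⟩
      q^2m² ⊛ βᵏ (suc k) m
        ∎
      where
      open ≋-Reasoning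
      open SeriesSolver using (solve; _:*_; _:=_)
      q^2m² = mono (2 ℕ.* (m ℕ.* m))
      F : ℕ → ℕ → PS
      F r n = αᵏ k r ⊛ (((mono (2 ℕ.* (n ℕ.* n)) ⊛ qp2⁻¹ (m ∸ n)) ⊛ qp2⁻¹ (n ∸ r)) ⊛ qp2⁻¹ (n ℕ.+ r))
      expand : ∀ n → (qp2⁻¹ (m ∸ n) ⊛ (mono (2 ℕ.* (n ℕ.* n)) ⊛ βᵏ k n)) ≋ ΣS< (suc n) (λ r → F r n)
      expand n = ≋.trans
        (solve 3 (λ a b c → a :* (b :* c) := (b :* a) :* c) ≋.refl (qp2⁻¹ (m ∸ n)) (mono (2 ℕ.* (n ℕ.* n))) (βᵏ k n))
        (≋.trans (⊛-ΣS (suc n) (mono (2 ℕ.* (n ℕ.* n)) ⊛ qp2⁻¹ (m ∸ n)) (λ r → αᵏ k r ⊛ (qp2⁻¹ (n ∸ r) ⊛ qp2⁻¹ (n ℕ.+ r))))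
          (ΣS-cong (suc n) (λ r _ → solve 5 (λ p q a i₁ i₂ → (p :* q) :* (a :* (i₁ :* i₂)) := a :* (((p :* q) :* i₁) :* i₂))
             ≋.refl (mono (2 ℕ.* (n ℕ.* n))) (qp2⁻¹ (m ∸ n)) (αᵏ k r) (qp2⁻¹ (n ∸ r)) (qp2⁻¹ (n ℕ.+ r)))))
      arith : ∀ r t → (r ℕ.+ t) ℕ.+ r ≡ 2 ℕ.* r ℕ.+ t
      arith = solve-∀
      sum-over-n : ∀ r → r ≤ m → ΣS< (suc m ∸ r) (λ t → F r (r ℕ.+ t)) ≋ (αᵏ (suc k) r ⊛ (qp2⁻¹ (m ∸ r) ⊛ qp2⁻¹ (m ℕ.+ r)))
      sum-over-n r r≤m = begin
        ΣS< (suc m ∸ r) (λ t → F r (r ℕ.+ t))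
          ≈⟨ ΣS-≡ (λ t → F r (r ℕ.+ t)) (NP.+-∸-assoc 1 r≤m) ⟩
        ΣS< (suc (m ∸ r)) (λ t → F r (r ℕ.+ t))
          ≈⟨ ΣS-cong (suc (m ∸ r)) (λ t _ → ≋.*-congˡ {αᵏ k r} (≋.*-cong
               (≋.*-congˡ {mono (2 ℕ.* ((r ℕ.+ t) ℕ.* (r ℕ.+ t))) ⊛ qp2⁻¹ (m ∸ (r ℕ.+ t))} (qp2⁻¹-≡ (NP.m+n∸m≡n r t)))
               (qp2⁻¹-≡ (arith r t)))) ⟩
        ΣS< (suc (m ∸ r)) (λ t → αᵏ k r ⊛ baileyTerm m r t)
          ≈⟨ ≋.sym (⊛-ΣS (suc (m ∸ r)) (αᵏ k r) (baileyTerm m r)) ⟩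
        αᵏ k r ⊛ ΣS< (suc (m ∸ r)) (baileyTerm m r)
          ≈⟨ αᵏ-bailey k m r r≤m ⟩
        αᵏ (suc k) r ⊛ (qp2⁻¹ (m ∸ r) ⊛ qp2⁻¹ (m ℕ.+ r))
          ∎

    thetaS≈[] : ∀ k N → thetaS x (suc k) ≈[ N ] ΣS< (suc N) (λ r → mono (2 ℕ.* (r ℕ.* r)) ⊛ αᵏ k r)
    thetaS≈[] k N n n≤N = sym (trans (Σ-cong′ (suc N) (λ r → summand≋ r n))
      (Σ-pad (suc n) (suc N) (λ r → scale (W x r) (mono (e r)) n) (s≤s n≤N) above-n))
      where
      open SeriesSolver using (solve; _:*_; _:=_)
      e : ℕ → ℕ
      e r = (2 ℕ.* suc k ℕ.+ 1) ℕ.* (r ℕ.* r)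
      arith₁ : ∀ k r → 2 ℕ.* (r ℕ.* r) ℕ.+ (2 ℕ.* (k ℕ.* (r ℕ.* r)) ℕ.+ r ℕ.* r) ≡ (2 ℕ.* suc k ℕ.+ 1) ℕ.* (r ℕ.* r)
      arith₁ = solve-∀
      arith₂ : ∀ k r → (2 ℕ.* suc k ℕ.+ 1) ℕ.* (r ℕ.* r) ≡ suc (suc (suc (2 ℕ.* k))) ℕ.* (r ℕ.* r)
      arith₂ = solve-∀
      above-n : ∀ r → suc n ≤ r → r < suc N → scale (W x r) (mono (e r)) n ≈ 0#
      above-n r n<r _ = trans (*-congˡ (mono-diff (e r) n (λ e≡n → NP.<-irrefl (P.sym e≡n)
        (NP.<-≤-trans n<r (P.subst (r ≤_) (P.sym (arith₂ k r)) (n≤[1+c]n² (suc (suc (2 ℕ.* k))) r)))))) (zeroʳ _)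
      summand≋ : ∀ r → (mono (2 ℕ.* (r ℕ.* r)) ⊛ αᵏ k r) ≋ scale (W x r) (mono (e r))
      summand≋ r = ≋.trans (≋.*-congˡ {q^2r²} (≋.*-congˡ {q^2kr²} (scale-mono (W x r) (r ℕ.* r))))
        (≋.trans (solve 4 (λ a b w c → a :* (b :* (w :* c)) := w :* (a :* (b :* c))) ≋.refl q^2r² q^2kr² (cst (W x r)) (mono (r ℕ.* r)))
          (≋.trans (≋.*-congˡ {cst (W x r)} (≋.trans (≋.*-congˡ {q^2r²} (mono-+ (2 ℕ.* (k ℕ.* (r ℕ.* r))) (r ℕ.* r)))
                      (≋.trans (mono-+ (2 ℕ.* (r ℕ.* r)) (2 ℕ.* (k ℕ.* (r ℕ.* r)) ℕ.+ r ℕ.* r)) (mono-≡ (arith₁ k r)))))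
            (cst-⊛ (W x r) (mono (e r)))))
        where
        q^2r² = mono (2 ℕ.* (r ℕ.* r))
        q^2kr² = mono (2 ℕ.* (k ℕ.* (r ℕ.* r)))

    LHS≈RHS : ∀ k N → LHS x (suc k) N ≈ RHS x (suc k) N
    LHS≈RHS k N = sym (begin
      Σ< (suc N) (λ m → chain x (suc k) m N)
        ≈⟨ Σ-cong′ (suc N) (λ m → trans (chain≋ k m N) (⊛-ΣS (suc m) (mono (2 ℕ.* (m ℕ.* m))) (summand m) N)) ⟩
      ΣS< (suc N) (λ m → ΣS< (suc m) (λ r → G m r)) N
        ≈⟨ ΣS-triangle (suc N) (λ r m → G m r) N ⟩
      ΣS< (suc N) (λ r → ΣS< (suc N ∸ r) (λ t → G (r ℕ.+ t) r)) N
        ≈⟨ Σ-cong (suc N) (λ r r≤N → sum-over-m r (NP.≤-pred r≤N)) ⟩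
      ΣS< (suc N) (λ r → qp2∞⁻¹ ⊛ (mono (2 ℕ.* (r ℕ.* r)) ⊛ αᵏ k r)) N
        ≈⟨ sym (⊛-ΣS (suc N) qp2∞⁻¹ (λ r → mono (2 ℕ.* (r ℕ.* r)) ⊛ αᵏ k r) N) ⟩
      (qp2∞⁻¹ ⊛ ΣS< (suc N) (λ r → mono (2 ℕ.* (r ℕ.* r)) ⊛ αᵏ k r)) N
        ≈⟨ sym (≈[]-⊛ (≈[]-refl {f = qp2∞⁻¹}) (thetaS≈[] k N) N NP.≤-refl) ⟩
      (qp2∞⁻¹ ⊛ thetaS x (suc k)) N
        ∎)
      where
      open ≈-Reasoning
      open SeriesSolver using (solve; _:*_; _:=_)
      summand : ℕ → ℕ → PS
      summand m r = αᵏ k r ⊛ (qp2⁻¹ (m ∸ r) ⊛ qp2⁻¹ (m ℕ.+ r))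
      G : ℕ → ℕ → PS
      G m r = mono (2 ℕ.* (m ℕ.* m)) ⊛ summand m r
      arith : ∀ r t → (r ℕ.+ t) ℕ.+ r ≡ 2 ℕ.* r ℕ.+ t
      arith = solve-∀
      G≋ : ∀ r t → G (r ℕ.+ t) r ≋ (αᵏ k r ⊛ limitTerm r t)
      G≋ r t = ≋.trans
        (≋.*-congˡ {mono (2 ℕ.* ((r ℕ.+ t) ℕ.* (r ℕ.+ t)))} (≋.*-congˡ {αᵏ k r}
           (≋.*-cong (qp2⁻¹-≡ (NP.m+n∸m≡n r t)) (qp2⁻¹-≡ (arith r t)))))
        (solve 4 (λ a b c d → a :* (b :* (c :* d)) := b :* ((a :* c) :* d)) ≋.refl
           (mono (2 ℕ.* ((r ℕ.+ t) ℕ.* (r ℕ.+ t)))) (αᵏ k r) (qp2⁻¹ t) (qp2⁻¹ (2 ℕ.* r ℕ.+ t)))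
      sum-over-m : ∀ r → r ≤ N → ΣS< (suc N ∸ r) (λ t → G (r ℕ.+ t) r) N ≈ (qp2∞⁻¹ ⊛ (mono (2 ℕ.* (r ℕ.* r)) ⊛ αᵏ k r)) N
      sum-over-m r r≤N = begin
        ΣS< (suc N ∸ r) (λ t → G (r ℕ.+ t) r) N
          ≈⟨ ΣS-cong (suc N ∸ r) (λ t _ → G≋ r t) N ⟩
        ΣS< (suc N ∸ r) (λ t → αᵏ k r ⊛ limitTerm r t) N
          ≈⟨ sym (⊛-ΣS (suc N ∸ r) (αᵏ k r) (limitTerm r) N) ⟩
        (αᵏ k r ⊛ ΣS< (suc N ∸ r) (limitTerm r)) N
          ≈⟨ ≈[]-⊛ (≈[]-refl {f = αᵏ k r}) (bailey-limit r N (suc N ∸ r) N<r+[1+N∸r]) N NP.≤-refl ⟩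
        (αᵏ k r ⊛ (mono (2 ℕ.* (r ℕ.* r)) ⊛ qp2∞⁻¹)) N
          ≈⟨ solve 3 (λ a m i → a :* (m :* i) := i :* (m :* a)) ≋.refl (αᵏ k r) (mono (2 ℕ.* (r ℕ.* r))) qp2∞⁻¹ N ⟩
        (qp2∞⁻¹ ⊛ (mono (2 ℕ.* (r ℕ.* r)) ⊛ αᵏ k r)) N
          ∎
        where
        N<r+[1+N∸r] : N < r ℕ.+ (suc N ∸ r)
        N<r+[1+N∸r] = P.subst (N <_) (P.sym (NP.m+[n∸m]≡n (NP.≤-trans r≤N (NP.n≤1+n N)))) NP.≤-refl

theorem4p5 : ∀ {c ℓ : Level} (R : CommutativeRing c ℓ)
               (x : CommutativeRing.Carrier R) (k : ℕ) → 1 ≤ k → (N : ℕ) →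
               CommutativeRing._≈_ R (Series.LHS R x k N) (Series.RHS R x k N)
theorem4p5 R x (suc k) (s≤s z≤n) N = LHS≈RHS R x k N
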